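{- Let $\mathbb{F}_q$ be a finite field and $n\ge 1$. Let $(V,W,g_1,g_2)$ be a partial isomorphism of $(\mathbb{F}_q)^n$ of degree $k$, and let $k_1=\dim \ker(g_2\circ g_1-\mathrm{id}_V)$ be the dimension of the space of fixed points of $g_2\circ g_1$. Let $W^+\supset W$ be a fixed subspace of $(\mathbb{F}_q)^n$ of dimension $k^+\ge k$. Then the number of trivial extensions $(V^+,W^+,g_1^+,g_2^+)$ of $(V,W,g_1,g_2)$ with right subspace $W^+$ (the left subspace $V^+$ being arbitrary) is $$E_q(n,k^+,k,k_1)=q^{(k-k_1)(k^+-k)}\,(q^n-q^k)(q^n-q^{k+1})\cdots(q^n-q^{k^+-1})=q^{(n+k-k_1)(k^+-k)}\,\frac{(q^{ -1})_{n-k}}{(q^{ -1})_{n-k^+}}.$$ The same number is obtained when $V^+\supset V$ of dimension $k^+$ is fixed and $W^+$ is arbitrary.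
   Context: A partial isomorphism of $(\mathbb{F}_q)^n$ is a quadruple $(V,W,g_1,g_2)$ where $V,W$ are subspaces of the same dimension $k$ (the degree) and $g_1:V\to W$, $g_2:W\to V$ are linear isomorphisms. An extension of it is a partial isomorphism $(V^+,W^+,g_1^+,g_2^+)$ with $V\subset V^+$, $W\subset W^+$, $g_1^+|_V=g_1$, $g_2^+|_W=g_2$. The extension is trivial if there are decompositions $V^+=V\oplus A$, $W^+=W\oplus B$ and a linear isomorphism $\psi:A\to B$ with $g_1^+=g_1\oplus\psi$ and $g_2^+=g_2\oplus\psi^{ -1}$ (equivalently, the isomorphisms $V^+/V\to W^+/W$ and $W^+/W\to V^+/V$ induced by $g_1^+$ and $g_2^+$ are mutually inverse). The Pochhammer symbol is $(x)_m=(1-x)(1-x^2)\cdots(1-x^m)$, $(x)_0=1$. -}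

module Defs where

open import Level using (0ℓ)
open import Data.Nat as ℕ using (ℕ; zero; suc)
open import Data.Fin using (Fin) renaming (zero to fzero; suc to fsuc)
open import Data.Vec using (Vec; replicate; zipWith; map)
open import Data.Product using (Σ; ∃; _×_; _,_)
open import Relation.Binary.PropositionalEquality using (_≡_)
open import Relation.Nullary using (¬_)
open import Function.Bundles using (_↔_)
open import Algebra.Structures using (IsCommutativeRing)

record FiniteField : Set₁ where
  field
    Carrier : Set
    _+_ _*_ : Carrier → Carrier → Carrier
    -_      : Carrier → Carrier
    0# 1#   : Carrier
    isCommutativeRing : IsCommutativeRing _≡_ _+_ _*_ -_ 0# 1#
    0≢1     : ¬ (0# ≡ 1#)
    inverse : ∀ x → ¬ (x ≡ 0#) → ∃ λ y → x * y ≡ 1#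
    q       : ℕ
    enum    : Fin q ↔ Carrier

module _ (F : FiniteField) where
  open FiniteField F

  Vect : ℕ → Set
  Vect n = Vec Carrier n

  module _ {n : ℕ} where

    zeroV : Vect n
    zeroV = replicate n 0#

    _+V_ : Vect n → Vect n → Vect n
    _+V_ = zipWith _+_

    _·V_ : Carrier → Vect n → Vect n
    c ·V v = map (c *_) v

    lincomb : {d : ℕ} → (Fin d → Carrier) → (Fin d → Vect n) → Vect n
    lincomb {zero}  c b = zeroV
    lincomb {suc d} c b = (c fzero ·V b fzero) +V lincomb (λ i → c (fsuc i)) (λ i → b (fsuc i))

    Pred : Set₁
    Pred = Vect n → Set

    _⊆_ : Pred → Pred → Set
    P ⊆ Q = ∀ v → P v → Q v

    record IsSubspace (P : Pred) : Set where
      field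
        zero∈ : P zeroV
        +-closed : ∀ x y → P x → P y → P (x +V y)
        ·-closed : ∀ c x → P x → P (c ·V x)

    HasDim : Pred → ℕ → Set
    HasDim P d = IsSubspace P × Σ (Fin d → Vect n) λ b →
        (∀ i → P (b i))
      × (∀ c → lincomb c b ≡ zeroV → ∀ i → c i ≡ 0#)
      × (∀ v → P v → ∃ λ c → lincomb c b ≡ v)

    record IsLinIso (P Q : Pred) (g : Vect n → Vect n) : Set where
      field
        mapsTo   : ∀ x → P x → Q (g x)
        additive : ∀ x y → P x → P y → g (x +V y) ≡ g x +V g y
        homog    : ∀ c x → P x → g (c ·V x) ≡ c ·V g x
        inj      : ∀ x y → P x → P y → g x ≡ g y → x ≡ y
        surj     : ∀ y → Q y → ∃ λ x → P x × g x ≡ y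

    record PartialIso : Set₁ where
      field
        V W    : Pred
        g₁ g₂  : Vect n → Vect n
        degree : ℕ
        dimV   : HasDim V degree
        dimW   : HasDim W degree
        iso₁   : IsLinIso V W g₁
        iso₂   : IsLinIso W V g₂

    open PartialIso

    Fix : PartialIso → Pred
    Fix P v = V P v × g₂ P (g₁ P v) ≡ v

    IsExtension : PartialIso → PartialIso → Set
    IsExtension P E =
        (V P ⊆ V E) × (W P ⊆ W E)
      × (∀ v → V P v → g₁ E v ≡ g₁ P v)
      × (∀ w → W P w → g₂ E w ≡ g₂ P w)

    -- the extension E of P is trivial: V⁺ = V ⊕ A, W⁺ = W ⊕ B, ψ : A ≅ B,
    -- g₁⁺ = g₁ ⊕ ψ and g₂⁺ = g₂ ⊕ ψ⁻¹
    IsTrivial : PartialIso → PartialIso → Set₁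
    IsTrivial P E = Σ Pred λ A → Σ Pred λ B → Σ (Vect n → Vect n) λ ψ →
        IsSubspace A × IsSubspace B
      × (A ⊆ V E) × (∀ x → V P x → A x → x ≡ zeroV)
      × (∀ x → V E x → ∃ λ v → ∃ λ a → V P v × A a × x ≡ v +V a)
      × (B ⊆ W E) × (∀ x → W P x → B x → x ≡ zeroV)
      × (∀ x → W E x → ∃ λ w → ∃ λ b → W P w × B b × x ≡ w +V b)
      × IsLinIso A B ψ
      -- g₁⁺ = g₁ ⊕ ψ, g₂⁺ = g₂ ⊕ ψ⁻¹ (agreement with g₁, g₂ on V, W is part of IsExtension)
      × (∀ a → A a → g₁ E a ≡ ψ a)
      × (∀ a → A a → g₂ E (ψ a) ≡ a)

    SamePI : PartialIso → PartialIso → Set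
    SamePI E E′ =
        (∀ v → (V E v → V E′ v) × (V E′ v → V E v))
      × (∀ w → (W E w → W E′ w) × (W E′ w → W E w))
      × (∀ v → V E v → g₁ E v ≡ g₁ E′ v)
      × (∀ w → W E w → g₂ E w ≡ g₂ E′ w)

    TrivExtRight : PartialIso → Pred → Set₁
    TrivExtRight P W⁺ = Σ PartialIso λ E →
      IsExtension P E × IsTrivial P E × (∀ w → (W E w → W⁺ w) × (W⁺ w → W E w))

    TrivExtLeft : PartialIso → Pred → Set₁
    TrivExtLeft P V⁺ = Σ PartialIso λ E →
      IsExtension P E × IsTrivial P E × (∀ v → (V E v → V⁺ v) × (V⁺ v → V E v))

    SameExt : {X : Set₁} → (X → PartialIso) → X → X → Set
    SameExt f x y = SamePI (f x) (f y)

HasCount : {A : Set₁} → (A → A → Set) → ℕ → Set₁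
HasCount {A} _~_ N = Σ (Fin N → A) λ f →
    (∀ i j → f i ~ f j → i ≡ j)
  × (∀ a → ∃ λ i → f i ~ a)

prodFrom : (q n k j : ℕ) → ℕ
prodFrom q n k zero    = 1
prodFrom q n k (suc j) = prodFrom q n k j ℕ.* (q ℕ.^ n ℕ.∸ q ℕ.^ (k ℕ.+ j))

Eq : (q n k⁺ k k₁ : ℕ) → ℕ
Eq q n k⁺ k k₁ = q ℕ.^ ((k ℕ.∸ k₁) ℕ.* (k⁺ ℕ.∸ k)) ℕ.* prodFrom q n k (k⁺ ℕ.∸ k)

module Submission where

-- Fix a basis bW of W and a completion u of it to a basis of W⁺; a trivial extension with
-- right space W⁺ is determined by xs = g₂⁺ u and the corrections cs = g₁⁺ xs − u.  The xs
-- must extend the basis g₂ bW of V to an independent family, which leaves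
-- (qⁿ − q^k)(qⁿ − q^(k+1))⋯(qⁿ − q^(k⁺−1)) choices.  Triviality means that some complement
-- A of V is mapped onto a complement B of W by mutually inverse maps; this holds exactly when
-- each correction c lies in W with g₂ c in the image of id − g₂ ∘ g₁ on V, an image of
-- dimension k − k₁, which gives the factor q^((k − k₁)(k⁺ − k)).  The left-handed count
-- follows by exchanging the roles of V and W.

open import Defs
open import Data.Nat using (ℕ; _≤_; _<_)
open import Data.Product using (_×_; proj₁; _,_)

module Counting where

  open import Data.Nat using (ℕ; zero; suc; _+_; _*_; _^_; _∸_; _≤_; s≤s; z≤n)
  open import Data.Nat.Properties using (+-suc; m+n∸m≡n)
  open import Data.Fin as Fin using (Fin; remQuot; combine) renaming (zero to fzero; suc to fsuc)
  open import Data.Fin.Properties using (remQuot-combine; combine-remQuot)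
  open import Data.Vec using (Vec; []; _∷_)
  open import Data.Vec.Properties using (∷-injective; ∷-injectiveˡ; ∷-injectiveʳ)
  open import Data.Product using (Σ; ∃; _×_; _,_; proj₁; proj₂; uncurry)
  open import Data.Empty using (⊥-elim)
  open import Data.Unit using (⊤; tt)
  open import Relation.Binary.PropositionalEquality
  open import Relation.Nullary using (¬_; Dec; yes; no; ¬?)
  open import Relation.Unary using (Decidable; ∁)
  open import Function.Bundles using (mk⇔)
  open import Data.List as List using (List; []; _∷_; length; filter; lookup; cartesianProductWith)
  open import Data.List.Properties using (length-++; length-map; length-tabulate)
  open import Data.List.Membership.Propositional using (_∈_; lose)
  open import Data.List.Membership.Propositional.Properties
    using (∈-lookup; ∈-map⁺; ∈-map⁻; ∈-allFin; ∈-filter⁺; ∈-filter⁻; ∈-cartesianProductWith⁺)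
  open import Data.List.Membership.Propositional.Properties.WithK using (unique∧set⇒bag)
  open import Data.List.Relation.Binary.BagAndSetEquality using (∼bag⇒↭)
  open import Data.List.Relation.Binary.Permutation.Propositional.Properties using (↭-length)
  open import Data.List.Relation.Unary.Any as Any using (any?; satisfied)
  open import Data.List.Relation.Unary.Any.Properties using (lookup-index)
  open import Data.List.Relation.Unary.All as All using ()
  open import Data.List.Relation.Unary.AllPairs using ([]; _∷_)
  open import Data.List.Relation.Unary.Unique.Propositional using (Unique)
  import Data.List.Relation.Unary.Unique.Propositional.Properties as Unique

  record Enumeration {X : Set} (S : X → Set) (N : ℕ) : Set where
    field
      element    : Fin N → X
      sound      : ∀ i → S (element i)
      injective  : ∀ i j → element i ≡ element j → i ≡ j
      surjective : ∀ x → S x → ∃ λ i → element i ≡ x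

  record Listing (X : Set) : Set where
    field
      list     : List X
      unique   : Unique list
      complete : ∀ x → x ∈ list

    size : ℕ
    size = length list

  module _ {X : Set} where

    length-filter+length-filter-∁ : {P : X → Set} (P? : Decidable P) (xs : List X) →
      length (filter P? xs) + length (filter (λ x → ¬? (P? x)) xs) ≡ length xs
    length-filter+length-filter-∁ P? [] = refl
    length-filter+length-filter-∁ P? (x ∷ xs) with P? x
    ... | yes _ = cong suc (length-filter+length-filter-∁ P? xs)
    ... | no _  = trans (+-suc _ _) (cong suc (length-filter+length-filter-∁ P? xs))

    lookup-injective : {xs : List X} → Unique xs → ∀ i j → lookup xs i ≡ lookup xs j → i ≡ j
    lookup-injective (_ ∷ _)    fzero    fzero    eq = refl
    lookup-injective (px ∷ _)   fzero    (fsuc j) eq = ⊥-elim (All.lookup px (∈-lookup j) eq)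
    lookup-injective (px ∷ _)   (fsuc i) fzero    eq = ⊥-elim (All.lookup px (∈-lookup i) (sym eq))
    lookup-injective (_ ∷ uxs)  (fsuc i) (fsuc j) eq = cong fsuc (lookup-injective uxs i j eq)

    module _ {S : X → Set} where

      Enumeration-fromList : (xs : List X) → Unique xs →
        (∀ {x} → x ∈ xs → S x) → (∀ {x} → S x → x ∈ xs) → Enumeration S (length xs)
      Enumeration-fromList xs uxs sound complete = record
        { element    = lookup xs
        ; sound      = λ i → sound (∈-lookup i)
        ; injective  = lookup-injective uxs
        ; surjective = λ x sx → let x∈xs = complete sx in Any.index x∈xs , sym (lookup-index x∈xs) }

      Enumeration-toList : ∀ {N} → Enumeration S N → Σ (List X) λ xs →
        Unique xs × length xs ≡ N × (∀ {x} → x ∈ xs → S x) × (∀ {x} → S x → x ∈ xs)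
      Enumeration-toList {N} E =
          List.map element (List.allFin N)
        , Unique.map⁺ (λ {i} {j} → injective i j) (Unique.allFin⁺ N)
        , trans (length-map element (List.allFin N)) (length-tabulate {n = N} (λ i → i))
        , (λ x∈ → let (i , _ , eq) = ∈-map⁻ element x∈ in subst S (sym eq) (sound i))
        , (λ sx → let (i , eq) = surjective _ sx in
                  subst (_∈ List.map element (List.allFin N)) eq (∈-map⁺ element (∈-allFin i)))
        where open Enumeration E

    Enumeration-size-unique : ∀ {S T : X → Set} {N M} → Enumeration S N → Enumeration T M →
      (∀ x → S x → T x) → (∀ x → T x → S x) → N ≡ M
    Enumeration-size-unique E G S⇒T T⇒S
      with Enumeration-toList E | Enumeration-toList G
    ... | xs , uxs , refl , xs⊆S , S⊆xs | ys , uys , refl , ys⊆T , T⊆ys =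
      ↭-length (∼bag⇒↭ (unique∧set⇒bag uxs uys
        (mk⇔ (λ x∈ → T⊆ys (S⇒T _ (xs⊆S x∈))) (λ y∈ → S⊆xs (T⇒S _ (ys⊆T y∈))))))

  module _ {X : Set} (L : Listing X) where
    open Listing L

    Σ? : {P : X → Set} → Decidable P → Dec (Σ X P)
    Σ? P? with any? P? list
    ... | yes p = yes (satisfied p)
    ... | no ¬p = no λ (x , px) → ¬p (lose (complete x) px)

    Enumeration-filter : {P : X → Set} (P? : Decidable P) → Enumeration P (length (filter P? list))
    Enumeration-filter P? = Enumeration-fromList _ (Unique.filter⁺ P? unique)
      (λ x∈ → proj₂ (∈-filter⁻ P? {xs = list} x∈)) (λ px → ∈-filter⁺ P? (complete _) px)

    Enumeration-∁ : ∀ {P : X → Set} {N} (P? : Decidable P) → Enumeration P N → Enumeration (∁ P) (size ∸ N)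
    Enumeration-∁ {P} {N} P? E = subst (Enumeration (∁ P)) size∁ (Enumeration-filter (λ x → ¬? (P? x)))
      where
      open ≡-Reasoning
      #P #∁P : ℕ
      #P  = length (filter P? list)
      #∁P = length (filter (λ x → ¬? (P? x)) list)
      size∁ : #∁P ≡ size ∸ N
      size∁ = begin
        #∁P             ≡⟨ m+n∸m≡n #P #∁P ⟨
        #P + #∁P ∸ #P   ≡⟨ cong₂ _∸_ (length-filter+length-filter-∁ P? list)
                             (Enumeration-size-unique (Enumeration-filter P?) E (λ _ p → p) (λ _ p → p)) ⟩
        size ∸ N        ∎

    Enumeration-all : Enumeration (λ _ → ⊤) size
    Enumeration-all = Enumeration-fromList list unique (λ _ → tt) (λ {x} _ → complete x)

  module _ {A : Set} (L : Listing A) where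
    open Listing L

    private
      vectors : ∀ d → List (Vec A d)
      vectors zero    = [] ∷ []
      vectors (suc d) = cartesianProductWith _∷_ list (vectors d)

      length-cartesianProductWith : ∀ {B C : Set} (f : A → B → C) (xs : List A) (ys : List B) →
        length (cartesianProductWith f xs ys) ≡ length xs * length ys
      length-cartesianProductWith f []       ys = refl
      length-cartesianProductWith f (x ∷ xs) ys = trans (length-++ (List.map (f x) ys))
        (cong₂ _+_ (length-map (f x) ys) (length-cartesianProductWith f xs ys))

      length-vectors : ∀ d → length (vectors d) ≡ size ^ d
      length-vectors zero    = refl
      length-vectors (suc d) = trans (length-cartesianProductWith _∷_ list (vectors d))
                                     (cong (size *_) (length-vectors d))

    Listing-Vec : (d : ℕ) → Listing (Vec A d)
    Listing-Vec d = record { list = vectors d ; unique = unique-vectors d ; complete = complete-vectors }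
      where
      unique-vectors : ∀ d → Unique (vectors d)
      unique-vectors zero    = All.[] ∷ []
      unique-vectors (suc d) = Unique.cartesianProductWith⁺ _∷_ ∷-injective unique (unique-vectors d)
      complete-vectors : ∀ {d} (v : Vec A d) → v ∈ vectors d
      complete-vectors []       = Any.here refl
      complete-vectors (x ∷ v) = ∈-cartesianProductWith⁺ _∷_ (complete x) (complete-vectors v)

    size-Listing-Vec : ∀ d → Listing.size (Listing-Vec d) ≡ size ^ d
    size-Listing-Vec = length-vectors

  module _ {X Y : Set} where

    Enumeration-map : ∀ {S : X → Set} {T : Y → Set} {N} (g : X → Y) →
      (∀ x → S x → T (g x)) → (∀ x y → S x → S y → g x ≡ g y → x ≡ y) →
      (∀ y → T y → ∃ λ x → S x × g x ≡ y) → Enumeration S N → Enumeration T N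
    Enumeration-map g S⇒T g-injective T⊆img E = record
      { element    = λ i → g (element i)
      ; sound      = λ i → S⇒T _ (sound i)
      ; injective  = λ i j eq → injective i j (g-injective _ _ (sound i) (sound j) eq)
      ; surjective = λ y ty → let (x , sx , gx≡y) = T⊆img y ty ; (i , eq) = surjective x sx
                              in i , trans (cong g eq) gx≡y }
      where open Enumeration E

    Enumeration-Σ : ∀ {S : X → Set} {T : X → Y → Set} {a b} → Enumeration S a →
      (∀ x → S x → Enumeration (T x) b) →
      Enumeration (λ (p : X × Y) → S (proj₁ p) × T (proj₁ p) (proj₂ p)) (a * b)
    Enumeration-Σ {S} {T} {a} {b} E G = record
      { element = λ k → pair (remQuot b k) ; sound = λ k → pair-sound (remQuot b k)
      ; injective = injective′ ; surjective = surjective′ }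
      where
      module E = Enumeration E
      module G x sx = Enumeration (G x sx)
      pair : Fin a × Fin b → X × Y
      pair (i , j) = E.element i , G.element (E.element i) (E.sound i) j
      pair-sound : ∀ p → S (proj₁ (pair p)) × T (proj₁ (pair p)) (proj₂ (pair p))
      pair-sound (i , j) = E.sound i , G.sound (E.element i) (E.sound i) j
      pair-injective : ∀ p q → pair p ≡ pair q → p ≡ q
      pair-injective (i , j) (i′ , j′) eq with E.injective i i′ (cong proj₁ eq)
      ... | refl = cong (i ,_) (G.injective (E.element i) (E.sound i) j j′ (cong proj₂ eq))
      injective′ : ∀ k k′ → pair (remQuot b k) ≡ pair (remQuot b k′) → k ≡ k′
      injective′ k k′ eq = trans (sym (combine-remQuot {a} b k))
        (trans (cong (uncurry combine) (pair-injective _ _ eq)) (combine-remQuot {a} b k′))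
      surjective′ : ∀ p → S (proj₁ p) × T (proj₁ p) (proj₂ p) → ∃ λ k → pair (remQuot b k) ≡ p
      surjective′ (x , y) (sx , ty) with E.surjective x sx
      ... | i , refl with G.surjective (E.element i) (E.sound i) y ty
      ... | j , eqj = combine i j , trans (cong pair (remQuot-combine i j)) (cong (E.element i ,_) eqj)

  module _ {X : Set} where

    Enumeration-[] : {R : Vec X 0 → Set} → R [] → Enumeration R 1
    Enumeration-[] r = record
      { element = λ _ → [] ; sound = λ { fzero → r } ; injective = λ { fzero fzero _ → refl }
      ; surjective = λ { [] _ → fzero , refl } }

    Enumeration-∷ : ∀ {j a b} {R : Vec X (suc j) → Set} {S : Vec X j → Set} {T : Vec X j → X → Set} →
      (∀ x xs → R (x ∷ xs) → S xs × T xs x) → (∀ x xs → S xs × T xs x → R (x ∷ xs)) →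
      Enumeration S a → (∀ xs → S xs → Enumeration (T xs) b) → Enumeration R (a * b)
    Enumeration-∷ R⇒ST ST⇒R E G = Enumeration-map (λ (xs , x) → x ∷ xs)
      (λ (xs , x) → ST⇒R x xs)
      (λ _ _ _ _ eq → cong₂ _,_ (∷-injectiveʳ eq) (∷-injectiveˡ eq))
      (λ { (x ∷ xs) r → (xs , x) , R⇒ST x xs r , refl })
      (Enumeration-Σ E G)

  Fin⇒1≤ : ∀ {N} → Fin N → 1 ≤ N
  Fin⇒1≤ {suc N} _ = s≤s z≤n

  distinct⇒2≤ : ∀ {N} (i j : Fin N) → ¬ i ≡ j → 2 ≤ N
  distinct⇒2≤ fzero    fzero    i≢j = ⊥-elim (i≢j refl)
  distinct⇒2≤ fzero    (fsuc j) _   = s≤s (Fin⇒1≤ j)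
  distinct⇒2≤ (fsuc i) _        _   = s≤s (Fin⇒1≤ i)

  HasCount-fromEnumeration : ∀ {A : Set₁} {_~_ : A → A → Set} {X : Set} {S : X → Set} {N} →
    Enumeration S N → (f : ∀ x → S x → A) →
    (∀ x y sx sy → f x sx ~ f y sy → x ≡ y) →
    (∀ a → Σ X λ x → Σ (S x) λ sx → f x sx ~ a) →
    (∀ x sx sx′ a → f x sx ~ a → f x sx′ ~ a) →
    HasCount _~_ N
  HasCount-fromEnumeration {_~_ = _~_} E f f-injective f-surjective f-irrelevant =
      (λ i → f (element i) (sound i))
    , (λ i j fi~fj → injective i j (f-injective _ _ (sound i) (sound j) fi~fj))
    , λ a → let (x , sx , fx~a) = f-surjective a in preimage x sx a fx~a
    where
    open Enumeration E
    preimage : ∀ x sx a → f x sx ~ a → ∃ λ i → f (element i) (sound i) ~ a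
    preimage x sx a fx~a with surjective x sx
    ... | i , refl = i , f-irrelevant _ sx (sound i) a fx~a

module Powers (q : ℕ) (1<q : 1 < q) where

  open import Data.Nat using (_*_; _^_; _∸_; _≤_; NonZero; >-nonZero; s≤s; z≤n)
  open import Data.Nat.Properties
  open import Data.Sum using (inj₁; inj₂)
  open import Data.Empty using (⊥-elim)
  open import Relation.Binary using (tri<; tri≈; tri>)
  open import Relation.Binary.PropositionalEquality

  instance
    q-nonZero : NonZero q
    q-nonZero = >-nonZero (<-trans (s≤s z≤n) 1<q)

  ^-injective : ∀ a b → q ^ a ≡ q ^ b → a ≡ b
  ^-injective a b eq with <-cmp a b
  ... | tri< a<b _ _ = ⊥-elim (<⇒≢ (^-monoʳ-< q 1<q a<b) eq)
  ... | tri≈ _ a≡b _ = a≡b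
  ... | tri> _ _ b<a = ⊥-elim (<⇒≢ (^-monoʳ-< q 1<q b<a) (sym eq))

  ^-cancel-≤ : ∀ a b → q ^ a ≤ q ^ b → a ≤ b
  ^-cancel-≤ a b le with ≤-<-connex a b
  ... | inj₁ a≤b = a≤b
  ... | inj₂ b<a = ⊥-elim (<⇒≱ (^-monoʳ-< q 1<q b<a) le)

  *-q^-cancel : ∀ N k k₁ → 1 ≤ N → N * q ^ k₁ ≡ q ^ k → N ≡ q ^ (k ∸ k₁)
  *-q^-cancel N k k₁ 1≤N eq = *-cancelʳ-≡ N (q ^ (k ∸ k₁)) (q ^ k₁) {{m^n≢0 q k₁}}
    (trans eq (trans (cong (q ^_) (sym (m∸n+n≡m k₁≤k))) (^-distribˡ-+-* q (k ∸ k₁) k₁)))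
    where
    k₁≤k : k₁ ≤ k
    k₁≤k = ^-cancel-≤ k₁ k (subst (q ^ k₁ ≤_) eq (m≤n*m (q ^ k₁) N {{>-nonZero 1≤N}}))

module VectorAlgebra (F : FiniteField) where

  open import Level using (0ℓ)
  open import Data.Nat using (ℕ; zero; suc)
  open import Data.Fin using (Fin) renaming (zero to fzero; suc to fsuc)
  open import Data.Vec using (Vec; []; _∷_; zipWith; map; _++_; lookup; tabulate)
  open import Data.Vec.Properties
    using (zipWith-assoc; zipWith-comm; zipWith-identityˡ; zipWith-identityʳ; zipWith-inverseˡ; zipWith-inverseʳ)
  open import Data.Vec.Relation.Unary.All using (All; []; _∷_)
  open import Data.Product using (_,_)
  open import Relation.Binary.PropositionalEquality
  open import Algebra.Bundles using (AbelianGroup)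
  open import Algebra.Structures using (IsCommutativeRing; IsAbelianGroup)
  import Algebra.Properties.AbelianGroup as AbelianGroupProperties
  import Algebra.Properties.CommutativeSemigroup as CommutativeSemigroupProperties

  open FiniteField F public
  open IsCommutativeRing isCommutativeRing
    using (+-assoc; +-comm; +-identityˡ; +-identityʳ; -‿inverseˡ; -‿inverseʳ;
           *-assoc; *-identityˡ; distribˡ; distribʳ; zeroˡ; zeroʳ)
  open ≡-Reasoning

  K : Set
  K = Carrier

  Vector : ℕ → Set
  Vector = Vect F

  infixl 6 _⊕_ _⊝_
  infixl 7 _⊙_

  𝟎 : ∀ {n} → Vector n
  𝟎 = zeroV F

  _⊕_ : ∀ {n} → Vector n → Vector n → Vector n
  _⊕_ = _+V_ F

  _⊙_ : ∀ {n} → K → Vector n → Vector n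
  _⊙_ = _·V_ F

  ⊖ : ∀ {n} → Vector n → Vector n
  ⊖ = map -_

  _⊝_ : ∀ {n} → Vector n → Vector n → Vector n
  u ⊝ v = u ⊕ ⊖ v

  module _ {n : ℕ} where

    ⊕-assoc : ∀ (u v w : Vector n) → (u ⊕ v) ⊕ w ≡ u ⊕ (v ⊕ w)
    ⊕-assoc = zipWith-assoc +-assoc

    ⊕-comm : ∀ (u v : Vector n) → u ⊕ v ≡ v ⊕ u
    ⊕-comm = zipWith-comm +-comm

    ⊕-identityˡ : ∀ (u : Vector n) → 𝟎 ⊕ u ≡ u
    ⊕-identityˡ = zipWith-identityˡ +-identityˡ

    ⊕-identityʳ : ∀ (u : Vector n) → u ⊕ 𝟎 ≡ u
    ⊕-identityʳ = zipWith-identityʳ +-identityʳ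

    ⊕-inverseʳ : ∀ (u : Vector n) → u ⊕ ⊖ u ≡ 𝟎
    ⊕-inverseʳ = zipWith-inverseʳ -‿inverseʳ

    ⊕-isAbelianGroup : IsAbelianGroup _≡_ (_⊕_ {n}) 𝟎 ⊖
    ⊕-isAbelianGroup = record
      { isGroup = record
        { isMonoid = record
          { isSemigroup = record
            { isMagma = record { isEquivalence = isEquivalence ; ∙-cong = cong₂ _⊕_ }
            ; assoc = ⊕-assoc }
          ; identity = ⊕-identityˡ , ⊕-identityʳ }
        ; inverse = zipWith-inverseˡ -‿inverseˡ , ⊕-inverseʳ
        ; ⁻¹-cong = cong ⊖ }
      ; comm = ⊕-comm }

    ⊕-abelianGroup : AbelianGroup 0ℓ 0ℓ
    ⊕-abelianGroup = record { isAbelianGroup = ⊕-isAbelianGroup }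

    ⊕-cancelˡ : ∀ (u v w : Vector n) → u ⊕ v ≡ u ⊕ w → v ≡ w
    ⊕-cancelˡ = AbelianGroupProperties.∙-cancelˡ ⊕-abelianGroup

    ⊕-inverseʳ-unique : ∀ (u v : Vector n) → u ⊕ v ≡ 𝟎 → v ≡ ⊖ u
    ⊕-inverseʳ-unique = AbelianGroupProperties.inverseʳ-unique ⊕-abelianGroup

    ⊖-involutive : ∀ (u : Vector n) → ⊖ (⊖ u) ≡ u
    ⊖-involutive = AbelianGroupProperties.⁻¹-involutive ⊕-abelianGroup

    x⊝y≡𝟎⇒x≡y : ∀ (u v : Vector n) → u ⊝ v ≡ 𝟎 → u ≡ v
    x⊝y≡𝟎⇒x≡y = AbelianGroupProperties.x∙y⁻¹≈ε⇒x≈y ⊕-abelianGroup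

    ⊕-interchange : ∀ (a b c d : Vector n) → (a ⊕ b) ⊕ (c ⊕ d) ≡ (a ⊕ c) ⊕ (b ⊕ d)
    ⊕-interchange = CommutativeSemigroupProperties.interchange (AbelianGroup.commutativeSemigroup ⊕-abelianGroup)

    ⊖-distrib-⊕ : ∀ (u v : Vector n) → ⊖ (u ⊕ v) ≡ ⊖ u ⊕ ⊖ v
    ⊖-distrib-⊕ u v = sym (AbelianGroupProperties.⁻¹-∙-comm ⊕-abelianGroup u v)

    ⊕-⊝-cancel : ∀ (u v : Vector n) → u ⊕ (v ⊝ u) ≡ v
    ⊕-⊝-cancel u v = trans (sym (⊕-assoc u v (⊖ u))) (AbelianGroupProperties.xyx⁻¹≈y ⊕-abelianGroup u v)

    ⊝-⊕-cancel : ∀ (u v : Vector n) → (v ⊝ u) ⊕ u ≡ v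
    ⊝-⊕-cancel u v = trans (⊕-comm (v ⊝ u) u) (⊕-⊝-cancel u v)

    ⊕-⊝-interchange : ∀ (a b c d : Vector n) → (a ⊕ b) ⊝ (c ⊕ d) ≡ (a ⊝ c) ⊕ (b ⊝ d)
    ⊕-⊝-interchange a b c d = trans (cong ((a ⊕ b) ⊕_) (⊖-distrib-⊕ c d)) (⊕-interchange a b (⊖ c) (⊖ d))

    ⊝-⊝-interchange : ∀ (a b c d : Vector n) → (a ⊝ b) ⊝ (c ⊝ d) ≡ (a ⊝ c) ⊝ (b ⊝ d)
    ⊝-⊝-interchange a b c d = begin
      (a ⊕ ⊖ b) ⊕ ⊖ (c ⊕ ⊖ d)      ≡⟨ cong ((a ⊕ ⊖ b) ⊕_) (⊖-distrib-⊕ c (⊖ d)) ⟩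
      (a ⊕ ⊖ b) ⊕ (⊖ c ⊕ ⊖ (⊖ d))  ≡⟨ ⊕-interchange a (⊖ b) (⊖ c) (⊖ (⊖ d)) ⟩
      (a ⊕ ⊖ c) ⊕ (⊖ b ⊕ ⊖ (⊖ d))  ≡⟨ cong ((a ⊕ ⊖ c) ⊕_) (⊖-distrib-⊕ b (⊖ d)) ⟨
      (a ⊕ ⊖ c) ⊕ ⊖ (b ⊕ ⊖ d)      ∎

  ⊙-distribˡ : ∀ {n} c (u v : Vector n) → c ⊙ (u ⊕ v) ≡ c ⊙ u ⊕ c ⊙ v
  ⊙-distribˡ c []      []      = refl
  ⊙-distribˡ c (a ∷ u) (b ∷ v) = cong₂ _∷_ (distribˡ c a b) (⊙-distribˡ c u v)

  ⊙-distribʳ : ∀ {n} a b (u : Vector n) → (a + b) ⊙ u ≡ a ⊙ u ⊕ b ⊙ u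
  ⊙-distribʳ a b []      = refl
  ⊙-distribʳ a b (x ∷ u) = cong₂ _∷_ (distribʳ x a b) (⊙-distribʳ a b u)

  ⊙-assoc : ∀ {n} a b (u : Vector n) → (a * b) ⊙ u ≡ a ⊙ (b ⊙ u)
  ⊙-assoc a b []      = refl
  ⊙-assoc a b (x ∷ u) = cong₂ _∷_ (*-assoc a b x) (⊙-assoc a b u)

  ⊙-identityˡ : ∀ {n} (u : Vector n) → 1# ⊙ u ≡ u
  ⊙-identityˡ []      = refl
  ⊙-identityˡ (x ∷ u) = cong₂ _∷_ (*-identityˡ x) (⊙-identityˡ u)

  ⊙-zeroˡ : ∀ {n} (u : Vector n) → 0# ⊙ u ≡ 𝟎
  ⊙-zeroˡ []      = refl
  ⊙-zeroˡ (x ∷ u) = cong₂ _∷_ (zeroˡ x) (⊙-zeroˡ u)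

  ⊙-zeroʳ : ∀ {n} c → c ⊙ 𝟎 {n} ≡ 𝟎
  ⊙-zeroʳ {zero}  c = refl
  ⊙-zeroʳ {suc n} c = cong₂ _∷_ (zeroʳ c) (⊙-zeroʳ c)

  ⊙-⊖ : ∀ {n} c (u : Vector n) → c ⊙ ⊖ u ≡ ⊖ (c ⊙ u)
  ⊙-⊖ c u = ⊕-inverseʳ-unique (c ⊙ u) (c ⊙ ⊖ u)
    (trans (sym (⊙-distribˡ c u (⊖ u))) (trans (cong (c ⊙_) (⊕-inverseʳ u)) (⊙-zeroʳ c)))

  -1⊙≡⊖ : ∀ {n} (u : Vector n) → (- 1#) ⊙ u ≡ ⊖ u
  -1⊙≡⊖ u = ⊕-inverseʳ-unique u ((- 1#) ⊙ u) (begin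
    u ⊕ (- 1#) ⊙ u         ≡⟨ cong (_⊕ (- 1#) ⊙ u) (⊙-identityˡ u) ⟨
    1# ⊙ u ⊕ (- 1#) ⊙ u    ≡⟨ ⊙-distribʳ 1# (- 1#) u ⟨
    (1# + (- 1#)) ⊙ u       ≡⟨ cong (_⊙ u) (-‿inverseʳ 1#) ⟩
    0# ⊙ u                  ≡⟨ ⊙-zeroˡ u ⟩
    𝟎                       ∎)

  lc : ∀ {n d} → Vec K d → Vec (Vector n) d → Vector n
  lc []      []      = 𝟎
  lc (c ∷ t) (b ∷ e) = c ⊙ b ⊕ lc t e

  lincomb≡lc : ∀ {n d} (c : Fin d → K) (b : Fin d → Vector n) → lincomb F c b ≡ lc (tabulate c) (tabulate b)
  lincomb≡lc {d = zero}  c b = refl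
  lincomb≡lc {d = suc d} c b = cong (c fzero ⊙ b fzero ⊕_) (lincomb≡lc (λ i → c (fsuc i)) (λ i → b (fsuc i)))

  lc-⊕ : ∀ {n d} (t s : Vec K d) (e : Vec (Vector n) d) → lc (t ⊕ s) e ≡ lc t e ⊕ lc s e
  lc-⊕ []      []      []      = sym (⊕-identityˡ 𝟎)
  lc-⊕ (a ∷ t) (b ∷ s) (x ∷ e) = begin
    (a + b) ⊙ x ⊕ lc (t ⊕ s) e           ≡⟨ cong₂ _⊕_ (⊙-distribʳ a b x) (lc-⊕ t s e) ⟩
    (a ⊙ x ⊕ b ⊙ x) ⊕ (lc t e ⊕ lc s e)  ≡⟨ ⊕-interchange (a ⊙ x) (b ⊙ x) (lc t e) (lc s e) ⟩
    (a ⊙ x ⊕ lc t e) ⊕ (b ⊙ x ⊕ lc s e)  ∎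

  lc-⊙ : ∀ {n d} c (t : Vec K d) (e : Vec (Vector n) d) → lc (c ⊙ t) e ≡ c ⊙ lc t e
  lc-⊙ c []      []      = sym (⊙-zeroʳ c)
  lc-⊙ c (a ∷ t) (x ∷ e) = begin
    (c * a) ⊙ x ⊕ lc (c ⊙ t) e    ≡⟨ cong₂ _⊕_ (⊙-assoc c a x) (lc-⊙ c t e) ⟩
    c ⊙ (a ⊙ x) ⊕ c ⊙ lc t e      ≡⟨ ⊙-distribˡ c (a ⊙ x) (lc t e) ⟨
    c ⊙ (a ⊙ x ⊕ lc t e)          ∎

  lc-𝟎 : ∀ {n d} (e : Vec (Vector n) d) → lc 𝟎 e ≡ 𝟎
  lc-𝟎 []      = refl
  lc-𝟎 (x ∷ e) = trans (cong₂ _⊕_ (⊙-zeroˡ x) (lc-𝟎 e)) (⊕-identityˡ 𝟎)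

  lc-⊖ : ∀ {n d} (t : Vec K d) (e : Vec (Vector n) d) → lc (⊖ t) e ≡ ⊖ (lc t e)
  lc-⊖ t e = ⊕-inverseʳ-unique (lc t e) (lc (⊖ t) e)
    (trans (sym (lc-⊕ t (⊖ t) e)) (trans (cong (λ s → lc s e) (⊕-inverseʳ t)) (lc-𝟎 e)))

  lc-⊝ : ∀ {n d} (t s : Vec K d) (e : Vec (Vector n) d) → lc (t ⊝ s) e ≡ lc t e ⊝ lc s e
  lc-⊝ t s e = trans (lc-⊕ t (⊖ s) e) (cong (lc t e ⊕_) (lc-⊖ s e))

  lc-++ : ∀ {n d d′} (t : Vec K d) (s : Vec K d′) (e : Vec (Vector n) d) (f : Vec (Vector n) d′) →
    lc (t ++ s) (e ++ f) ≡ lc t e ⊕ lc s f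
  lc-++ []      s []      f = sym (⊕-identityˡ (lc s f))
  lc-++ (a ∷ t) s (x ∷ e) f = trans (cong (a ⊙ x ⊕_) (lc-++ t s e f)) (sym (⊕-assoc (a ⊙ x) (lc t e) (lc s f)))

  lc-zipWith-⊕ : ∀ {n d} (t : Vec K d) (e f : Vec (Vector n) d) → lc t (zipWith _⊕_ e f) ≡ lc t e ⊕ lc t f
  lc-zipWith-⊕ []      []      []      = sym (⊕-identityˡ 𝟎)
  lc-zipWith-⊕ (a ∷ t) (x ∷ e) (y ∷ f) = begin
    a ⊙ (x ⊕ y) ⊕ lc t (zipWith _⊕_ e f)   ≡⟨ cong₂ _⊕_ (⊙-distribˡ a x y) (lc-zipWith-⊕ t e f) ⟩
    (a ⊙ x ⊕ a ⊙ y) ⊕ (lc t e ⊕ lc t f)    ≡⟨ ⊕-interchange (a ⊙ x) (a ⊙ y) (lc t e) (lc t f) ⟩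
    (a ⊙ x ⊕ lc t e) ⊕ (a ⊙ y ⊕ lc t f)    ∎

  unit : ∀ {d} → Fin d → Vec K d
  unit fzero    = 1# ∷ 𝟎
  unit (fsuc i) = 0# ∷ unit i

  lc-unit : ∀ {n d} (i : Fin d) (e : Vec (Vector n) d) → lc (unit i) e ≡ lookup e i
  lc-unit fzero    (x ∷ e) = trans (cong₂ _⊕_ (⊙-identityˡ x) (lc-𝟎 e)) (⊕-identityʳ x)
  lc-unit (fsuc i) (x ∷ e) = trans (cong₂ _⊕_ (⊙-zeroˡ x) (lc-unit i e)) (⊕-identityˡ _)

  module Subspace {n : ℕ} {P : Pred F {n}} (S : IsSubspace F P) where
    open IsSubspace S public

    lc-closed : ∀ {d} (t : Vec K d) (e : Vec (Vector n) d) → All P e → P (lc t e)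
    lc-closed []      []      []         = zero∈
    lc-closed (a ∷ t) (x ∷ e) (px ∷ pe) = +-closed _ _ (·-closed a x px) (lc-closed t e pe)

    ⊖-closed : ∀ x → P x → P (⊖ x)
    ⊖-closed x px = subst P (-1⊙≡⊖ x) (·-closed (- 1#) x px)

    ⊝-closed : ∀ x y → P x → P y → P (x ⊝ y)
    ⊝-closed x y px py = +-closed x (⊖ y) px (⊖-closed y py)

    zipWith-⊕-closed : ∀ {d} {xs ys : Vec (Vector n) d} → All P xs → All P ys → All P (zipWith _⊕_ xs ys)
    zipWith-⊕-closed []         []         = []
    zipWith-⊕-closed (px ∷ pxs) (py ∷ pys) = +-closed _ _ px py ∷ zipWith-⊕-closed pxs pys

  module LinearMap {n : ℕ} {P Q : Pred F {n}} (S : IsSubspace F P) {g : Vector n → Vector n}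
                   (iso : IsLinIso F P Q g) where
    open Subspace S
    open IsLinIso iso

    map-𝟎 : g 𝟎 ≡ 𝟎
    map-𝟎 = begin
      g 𝟎          ≡⟨ cong g (⊙-zeroˡ 𝟎) ⟨
      g (0# ⊙ 𝟎)   ≡⟨ homog 0# 𝟎 zero∈ ⟩
      0# ⊙ g 𝟎     ≡⟨ ⊙-zeroˡ (g 𝟎) ⟩
      𝟎            ∎

    map-⊖ : ∀ x → P x → g (⊖ x) ≡ ⊖ (g x)
    map-⊖ x px = ⊕-inverseʳ-unique (g x) (g (⊖ x))
      (trans (sym (additive x (⊖ x) px (⊖-closed x px))) (trans (cong g (⊕-inverseʳ x)) map-𝟎))

    map-⊝ : ∀ x y → P x → P y → g (x ⊝ y) ≡ g x ⊝ g y
    map-⊝ x y px py = trans (additive x (⊖ y) px (⊖-closed y py)) (cong (g x ⊕_) (map-⊖ y py))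

    map-zipWith-⊕ : ∀ {d} (xs ys : Vec (Vector n) d) → All P xs → All P ys →
      map g (zipWith _⊕_ xs ys) ≡ zipWith _⊕_ (map g xs) (map g ys)
    map-zipWith-⊕ []       []       []         []         = refl
    map-zipWith-⊕ (x ∷ xs) (y ∷ ys) (px ∷ pxs) (py ∷ pys) = cong₂ _∷_ (additive x y px py) (map-zipWith-⊕ xs ys pxs pys)

    map-lc : ∀ {d} (t : Vec K d) (e : Vec (Vector n) d) → All P e → g (lc t e) ≡ lc t (map g e)
    map-lc []      []      []         = map-𝟎
    map-lc (a ∷ t) (x ∷ e) (px ∷ pe) = begin
      g (a ⊙ x ⊕ lc t e)       ≡⟨ additive (a ⊙ x) (lc t e) (·-closed a x px) (lc-closed t e pe) ⟩
      g (a ⊙ x) ⊕ g (lc t e)   ≡⟨ cong₂ _⊕_ (homog a x px) (map-lc t e pe) ⟩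
      a ⊙ g x ⊕ lc t (map g e) ∎

module Span (F : FiniteField) where

  open import Data.Nat using (ℕ; zero; suc; _^_; _∸_; _≤_)
  open import Data.Fin as Fin using (Fin) renaming (zero to fzero; suc to fsuc)
  open import Data.Vec using (Vec; []; _∷_; zipWith; map; _++_; lookup; tabulate; splitAt)
  open import Data.Vec.Properties
    using (≡-dec; ∷-injectiveˡ; ∷-injectiveʳ; ++-injectiveˡ; ++-injectiveʳ; lookup-map;
           lookup-replicate; lookup∘tabulate; tabulate∘lookup)
  open import Data.Vec.Relation.Binary.Pointwise.Extensional using (ext; Pointwise-≡⇒≡)
  open import Data.Vec.Relation.Unary.All as All using (All; []; _∷_)
  open import Data.Vec.Relation.Unary.All.Properties using (lookup⁻; tabulate⁺; map⁺)
  open import Data.Product using (Σ; ∃; _×_; _,_; proj₁; proj₂)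
  open import Data.Empty using (⊥-elim)
  open import Data.Unit using (tt)
  open import Relation.Binary.PropositionalEquality
  open import Relation.Nullary using (¬_; Dec; yes; no)
  open import Relation.Nullary.Decidable using (map′)
  open import Function.Bundles using (Inverse)
  open import Algebra.Structures using (IsCommutativeRing)
  open import Data.List as List using ()
  open import Data.List.Properties using (length-map; length-tabulate)
  open import Data.List.Membership.Propositional using (_∈_)
  open import Data.List.Membership.Propositional.Properties using (∈-map⁺; ∈-allFin)
  import Data.List.Relation.Unary.Unique.Propositional.Properties as Unique

  open Counting
  open VectorAlgebra F

  open IsCommutativeRing isCommutativeRing using (*-comm)
  open ≡-Reasoning

  from-injective : ∀ x y → Inverse.from enum x ≡ Inverse.from enum y → x ≡ y
  from-injective x y eq = trans (sym (strictlyInverseˡ x)) (trans (cong to eq) (strictlyInverseˡ y))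
    where open Inverse enum

  2≤q : 2 ≤ q
  2≤q = distinct⇒2≤ (Inverse.from enum 0#) (Inverse.from enum 1#) (λ eq → 0≢1 (from-injective 0# 1# eq))

  _≟K_ : (x y : K) → Dec (x ≡ y)
  x ≟K y = map′ (from-injective x y) (cong (Inverse.from enum)) (Inverse.from enum x Fin.≟ Inverse.from enum y)

  _≟_ : ∀ {n} (x y : Vector n) → Dec (x ≡ y)
  _≟_ = ≡-dec _≟K_

  scalars : Listing K
  scalars = record
    { list     = List.map to (List.allFin q)
    ; unique   = Unique.map⁺ (λ {i} {j} eq → trans (sym (strictlyInverseʳ i))
                   (trans (cong from eq) (strictlyInverseʳ j))) (Unique.allFin⁺ q)
    ; complete = λ x → subst (_∈ List.map to (List.allFin q)) (strictlyInverseˡ x) (∈-map⁺ to (∈-allFin (from x))) }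
    where open Inverse enum

  coefficients : ∀ d → Listing (Vec K d)
  coefficients = Listing-Vec scalars

  size-coefficients : ∀ d → Listing.size (coefficients d) ≡ q ^ d
  size-coefficients d = trans (size-Listing-Vec scalars d)
    (cong (_^ d) (trans (length-map _ (List.allFin q)) (length-tabulate {n = q} (λ i → i))))

  InSpan : ∀ {n d} → Vec (Vector n) d → Pred F {n}
  InSpan {d = d} e v = Σ (Vec K d) λ t → lc t e ≡ v

  InSpan? : ∀ {n d} (e : Vec (Vector n) d) v → Dec (InSpan e v)
  InSpan? {d = d} e v = Σ? (coefficients d) (λ t → lc t e ≟ v)

  span-isSubspace : ∀ {n d} (e : Vec (Vector n) d) → IsSubspace F (InSpan e)
  span-isSubspace e = record
    { zero∈    = 𝟎 , lc-𝟎 e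
    ; +-closed = λ { _ _ (t , refl) (s , refl) → t ⊕ s , lc-⊕ t s e }
    ; ·-closed = λ { c _ (t , refl) → c ⊙ t , lc-⊙ c t e } }

  span-∋ : ∀ {n d} (e : Vec (Vector n) d) → All (InSpan e) e
  span-∋ e = lookup⁻ λ i → unit i , lc-unit i e

  Independent : ∀ {n d} → Vec (Vector n) d → Set
  Independent {d = d} e = ∀ (t s : Vec K d) → lc t e ≡ lc s e → t ≡ s

  kernel-trivial⇒Independent : ∀ {n d} {e : Vec (Vector n) d} → (∀ t → lc t e ≡ 𝟎 → t ≡ 𝟎) → Independent e
  kernel-trivial⇒Independent {e = e} trivial t s eq =
    x⊝y≡𝟎⇒x≡y t s (trivial (t ⊝ s) (trans (lc-⊝ t s e) (trans (cong (_⊝ lc s e) eq) (⊕-inverseʳ _))))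

  Independent-∷ : ∀ {n d} {e : Vec (Vector n) d} {x} → Independent e → ¬ InSpan e x → Independent (x ∷ e)
  Independent-∷ {e = e} {x} ind x∉ = kernel-trivial⇒Independent trivial
    where
    trivial : ∀ t → lc t (x ∷ e) ≡ 𝟎 → t ≡ 𝟎
    trivial (a ∷ t) eq with a ≟K 0#
    ... | yes refl = cong (0# ∷_) (ind t 𝟎 (begin
      lc t e             ≡⟨ ⊕-identityˡ (lc t e) ⟨
      𝟎 ⊕ lc t e         ≡⟨ cong (_⊕ lc t e) (⊙-zeroˡ x) ⟨
      0# ⊙ x ⊕ lc t e    ≡⟨ eq ⟩
      𝟎                  ≡⟨ lc-𝟎 e ⟨
      lc 𝟎 e             ∎))
    ... | no a≢0 with inverse a a≢0
    ... | b , ab≡1 = ⊥-elim (x∉ (⊖ (b ⊙ t) , (begin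
      lc (⊖ (b ⊙ t)) e    ≡⟨ lc-⊖ (b ⊙ t) e ⟩
      ⊖ (lc (b ⊙ t) e)    ≡⟨ cong ⊖ (lc-⊙ b t e) ⟩
      ⊖ (b ⊙ lc t e)      ≡⟨ ⊙-⊖ b (lc t e) ⟨
      b ⊙ ⊖ (lc t e)      ≡⟨ cong (b ⊙_) ax≡-lc ⟨
      b ⊙ (a ⊙ x)         ≡⟨ ⊙-assoc b a x ⟨
      (b * a) ⊙ x         ≡⟨ cong (_⊙ x) (trans (*-comm b a) ab≡1) ⟩
      1# ⊙ x              ≡⟨ ⊙-identityˡ x ⟩
      x                   ∎)))
      where
      ax≡-lc : a ⊙ x ≡ ⊖ (lc t e)
      ax≡-lc = ⊕-inverseʳ-unique (lc t e) (a ⊙ x) (trans (⊕-comm (lc t e) (a ⊙ x)) eq)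

  Independent-tail : ∀ {n d} {e : Vec (Vector n) d} {x} → Independent (x ∷ e) → Independent e
  Independent-tail {x = x} ind t s eq = ∷-injectiveʳ (ind (0# ∷ t) (0# ∷ s) (cong (0# ⊙ x ⊕_) eq))

  Independent-head : ∀ {n d} {e : Vec (Vector n) d} {x} → Independent (x ∷ e) → ¬ InSpan e x
  Independent-head {e = e} {x} ind (t , eq) = 0≢1 (sym (∷-injectiveˡ (ind (1# ∷ 𝟎) (0# ∷ t) (begin
    1# ⊙ x ⊕ lc 𝟎 e    ≡⟨ cong₂ _⊕_ (⊙-identityˡ x) (lc-𝟎 e) ⟩
    x ⊕ 𝟎              ≡⟨ ⊕-identityʳ x ⟩
    x                  ≡⟨ eq ⟨
    lc t e             ≡⟨ ⊕-identityˡ (lc t e) ⟨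
    𝟎 ⊕ lc t e         ≡⟨ cong (_⊕ lc t e) (⊙-zeroˡ x) ⟨
    0# ⊙ x ⊕ lc t e    ∎))))

  Independent-++ : ∀ {n m d} {u : Vec (Vector n) m} {e : Vec (Vector n) d} → Independent (u ++ e) →
    ∀ t s t′ s′ → lc t u ⊕ lc s e ≡ lc t′ u ⊕ lc s′ e → t ≡ t′ × s ≡ s′
  Independent-++ {u = u} {e} ind t s t′ s′ eq =
    let ts≡t′s′ = ind (t ++ s) (t′ ++ s′) (trans (lc-++ t s u e) (trans eq (sym (lc-++ t′ s′ u e))))
    in ++-injectiveˡ t t′ ts≡t′s′ , ++-injectiveʳ t t′ ts≡t′s′

  Independent-++-disjoint : ∀ {n m d} {u : Vec (Vector n) m} {e : Vec (Vector n) d} → Independent (u ++ e) →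
    ∀ s t → lc s u ≡ lc t e → s ≡ 𝟎
  Independent-++-disjoint {u = u} {e} ind s t eq = proj₁ (Independent-++ ind s 𝟎 𝟎 t (begin
    lc s u ⊕ lc 𝟎 e  ≡⟨ cong (lc s u ⊕_) (lc-𝟎 e) ⟩
    lc s u ⊕ 𝟎       ≡⟨ ⊕-identityʳ _ ⟩
    lc s u           ≡⟨ eq ⟩
    lc t e           ≡⟨ ⊕-identityˡ _ ⟨
    𝟎 ⊕ lc t e       ≡⟨ cong (_⊕ lc t e) (lc-𝟎 u) ⟨
    lc 𝟎 u ⊕ lc t e  ∎))

  span-size : ∀ {n d} (e : Vec (Vector n) d) → Independent e → Enumeration (InSpan e) (q ^ d)
  span-size {d = d} e ind = subst (Enumeration (InSpan e)) (size-coefficients d)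
    (Enumeration-map (λ t → lc t e) (λ t _ → t , refl) (λ t s _ _ → ind t s)
      (λ { _ (t , refl) → t , tt , refl }) (Enumeration-all (coefficients d)))

  nonspan-size : ∀ {n d} (e : Vec (Vector n) d) → Independent e → Enumeration (λ v → ¬ InSpan e v) (q ^ n ∸ q ^ d)
  nonspan-size {n} {d} e ind = subst (λ N → Enumeration (λ v → ¬ InSpan e v) (N ∸ q ^ d)) (size-coefficients n)
    (Enumeration-∁ (coefficients n) (InSpan? e) (span-size e ind))

  -- The linear map sending e to f; off the span of e it is 𝟎, a value that is never used.
  linearExtension : ∀ {n d} → Vec (Vector n) d → Vec (Vector n) d → Vector n → Vector n
  linearExtension e f v with InSpan? e v
  ... | yes (t , _) = lc t f
  ... | no _        = 𝟎

  module _ {n d} {e f : Vec (Vector n) d} (ind : Independent e) where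

    linearExtension-lc : ∀ t → linearExtension e f (lc t e) ≡ lc t f
    linearExtension-lc t with InSpan? e (lc t e)
    ... | yes (t′ , eq) = cong (λ s → lc s f) (ind t′ t eq)
    ... | no t∉         = ⊥-elim (t∉ (t , refl))

    map-linearExtension : map (linearExtension e f) e ≡ f
    map-linearExtension = Pointwise-≡⇒≡ (ext λ i → begin
      lookup (map (linearExtension e f) e) i  ≡⟨ lookup-map i (linearExtension e f) e ⟩
      linearExtension e f (lookup e i)        ≡⟨ cong (linearExtension e f) (lc-unit i e) ⟨
      linearExtension e f (lc (unit i) e)     ≡⟨ linearExtension-lc (unit i) ⟩
      lc (unit i) f                           ≡⟨ lc-unit i f ⟩
      lookup f i                              ∎)

    linearExtension-isLinIso : Independent f → (P Q : Pred F {n}) →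
      (∀ v → P v → InSpan e v) → (∀ v → InSpan e v → P v) →
      (∀ v → Q v → InSpan f v) → (∀ v → InSpan f v → Q v) → IsLinIso F P Q (linearExtension e f)
    linearExtension-isLinIso indf P Q P⊆ ⊆P Q⊆ ⊆Q = record
      { mapsTo   = λ x px → mapsTo (P⊆ x px)
      ; additive = λ x y px py → additive (P⊆ x px) (P⊆ y py)
      ; homog    = λ c x px → homog c (P⊆ x px)
      ; inj      = λ x y px py → inj (P⊆ x px) (P⊆ y py)
      ; surj     = surj }
      where
      g = linearExtension e f
      mapsTo : ∀ {x} → InSpan e x → Q (g x)
      mapsTo (t , refl) = ⊆Q _ (t , sym (linearExtension-lc t))
      additive : ∀ {x y} → InSpan e x → InSpan e y → g (x ⊕ y) ≡ g x ⊕ g y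
      additive (t , refl) (s , refl) = begin
        g (lc t e ⊕ lc s e)  ≡⟨ cong g (lc-⊕ t s e) ⟨
        g (lc (t ⊕ s) e)     ≡⟨ linearExtension-lc (t ⊕ s) ⟩
        lc (t ⊕ s) f         ≡⟨ lc-⊕ t s f ⟩
        lc t f ⊕ lc s f      ≡⟨ cong₂ _⊕_ (linearExtension-lc t) (linearExtension-lc s) ⟨
        g (lc t e) ⊕ g (lc s e) ∎
      homog : ∀ c {x} → InSpan e x → g (c ⊙ x) ≡ c ⊙ g x
      homog c (t , refl) = begin
        g (c ⊙ lc t e)    ≡⟨ cong g (lc-⊙ c t e) ⟨
        g (lc (c ⊙ t) e)  ≡⟨ linearExtension-lc (c ⊙ t) ⟩
        lc (c ⊙ t) f      ≡⟨ lc-⊙ c t f ⟩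
        c ⊙ lc t f        ≡⟨ cong (c ⊙_) (linearExtension-lc t) ⟨
        c ⊙ g (lc t e)    ∎
      inj : ∀ {x y} → InSpan e x → InSpan e y → g x ≡ g y → x ≡ y
      inj (t , refl) (s , refl) eq = cong (λ r → lc r e)
        (indf t s (trans (sym (linearExtension-lc t)) (trans eq (linearExtension-lc s))))
      surj : ∀ y → Q y → ∃ λ x → P x × g x ≡ y
      surj y qy with Q⊆ y qy
      ... | t , refl = lc t e , ⊆P _ (t , refl) , linearExtension-lc t

  module Basis {n d} {P : Pred F {n}} (hd : HasDim F P d) where
    private
      b = proj₁ (proj₂ hd)

    basis : Vec (Vector n) d
    basis = tabulate b

    basis-independent : Independent basis
    basis-independent = kernel-trivial⇒Independent λ t eq → Pointwise-≡⇒≡ (ext λ i →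
      trans (proj₁ (proj₂ (proj₂ (proj₂ hd))) (lookup t)
              (trans (lincomb≡lc (lookup t) b) (trans (cong (λ s → lc s basis) (tabulate∘lookup t)) eq)) i)
            (sym (lookup-replicate i 0#)))

    basis-spans : ∀ v → P v → InSpan basis v
    basis-spans v pv with proj₂ (proj₂ (proj₂ (proj₂ hd))) v pv
    ... | c , eq = tabulate c , trans (sym (lincomb≡lc c b)) eq

    basis-∈ : All P basis
    basis-∈ = tabulate⁺ (proj₁ (proj₂ (proj₂ hd)))

    span-basis⊆ : ∀ v → InSpan basis v → P v
    span-basis⊆ v (t , refl) = Subspace.lc-closed (proj₁ hd) t basis basis-∈

  span-hasDim : ∀ {n d} (e : Vec (Vector n) d) → Independent e → HasDim F (InSpan e) d
  span-hasDim e ind = span-isSubspace e , lookup e , (λ i → unit i , lc-unit i e) , indep , spans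
    where
    lincomb≡lc′ : ∀ c → lincomb F c (lookup e) ≡ lc (tabulate c) e
    lincomb≡lc′ c = trans (lincomb≡lc c (lookup e)) (cong (lc (tabulate c)) (tabulate∘lookup e))
    indep : ∀ c → lincomb F c (lookup e) ≡ 𝟎 → ∀ i → c i ≡ 0#
    indep c eq i = begin
      c i                    ≡⟨ lookup∘tabulate c i ⟨
      lookup (tabulate c) i  ≡⟨ cong (λ s → lookup s i) (ind (tabulate c) 𝟎
                                  (trans (sym (lincomb≡lc′ c)) (trans eq (sym (lc-𝟎 e))))) ⟩
      lookup 𝟎 i             ≡⟨ lookup-replicate i 0# ⟩
      0#                     ∎
    spans : ∀ v → InSpan e v → ∃ λ c → lincomb F c (lookup e) ≡ v
    spans _ (t , refl) = lookup t , trans (lincomb≡lc′ (lookup t)) (cong (λ s → lc s e) (tabulate∘lookup t))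

  lc-𝟎-++ : ∀ {n m d} (t : Vec K d) (u : Vec (Vector n) m) (b : Vec (Vector n) d) → lc (𝟎 ++ t) (u ++ b) ≡ lc t b
  lc-𝟎-++ t u b = trans (lc-++ 𝟎 t u b) (trans (cong (_⊕ lc t b) (lc-𝟎 u)) (⊕-identityˡ (lc t b)))

  lc-++-𝟎 : ∀ {n m d} (s : Vec K m) (u : Vec (Vector n) m) (b : Vec (Vector n) d) → lc (s ++ 𝟎) (u ++ b) ≡ lc s u
  lc-++-𝟎 s u b = trans (lc-++ s 𝟎 u b) (trans (cong (lc s u ⊕_) (lc-𝟎 b)) (⊕-identityʳ (lc s u)))

  InSpan-++ʳ : ∀ {n m d} (u : Vec (Vector n) m) {b : Vec (Vector n) d} {v} → InSpan b v → InSpan (u ++ b) v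
  InSpan-++ʳ u {b} (t , eq) = 𝟎 ++ t , trans (lc-𝟎-++ t u b) eq

  InSpan-++ˡ : ∀ {n m d} {u : Vec (Vector n) m} (b : Vec (Vector n) d) {v} → InSpan u v → InSpan (u ++ b) v
  InSpan-++ˡ {u = u} b (s , eq) = s ++ 𝟎 , trans (lc-++-𝟎 s u b) eq

  InSpan-++⁻ : ∀ {n m d} (u : Vec (Vector n) m) (b : Vec (Vector n) d) {v} → InSpan (u ++ b) v →
    Σ (Vec K m) λ s → Σ (Vec K d) λ t → lc s u ⊕ lc t b ≡ v
  InSpan-++⁻ {m = m} u b (st , eq) with splitAt m st
  ... | s , t , refl = s , t , trans (sym (lc-++ s t u b)) eq

  linearExtension-++ʳ : ∀ {n m d} {u u′ : Vec (Vector n) m} {b b′ : Vec (Vector n) d} → Independent (u ++ b) →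
    ∀ t → linearExtension (u ++ b) (u′ ++ b′) (lc t b) ≡ lc t b′
  linearExtension-++ʳ {u = u} {u′} {b} {b′} ind t = begin
    linearExtension (u ++ b) (u′ ++ b′) (lc t b)                ≡⟨ cong (linearExtension (u ++ b) (u′ ++ b′)) (lc-𝟎-++ t u b) ⟨
    linearExtension (u ++ b) (u′ ++ b′) (lc (𝟎 ++ t) (u ++ b))  ≡⟨ linearExtension-lc ind (𝟎 ++ t) ⟩
    lc (𝟎 ++ t) (u′ ++ b′)                                      ≡⟨ lc-𝟎-++ t u′ b′ ⟩
    lc t b′                                                     ∎

  -- If b and b′ both span the subspace Q and cs lies in Q, then adding cs to u
  -- and replacing b by b′ changes neither the span nor the independence of u ++ b.
  module Shift {n} {Q : Pred F {n}} (SQ : IsSubspace F Q) {d} (b b′ : Vec (Vector n) d)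
               (Q⊆b : ∀ v → Q v → InSpan b v) (b⊆Q : ∀ v → InSpan b v → Q v)
               (Q⊆b′ : ∀ v → Q v → InSpan b′ v) (b′⊆Q : ∀ v → InSpan b′ v → Q v) where
    open Subspace SQ

    module _ {m} (u cs : Vec (Vector n) m) (cs∈Q : All Q cs) where
      ucs : Vec (Vector n) m
      ucs = zipWith _⊕_ u cs

      private
        regroup : ∀ s r t′ → lc r b ≡ lc s cs ⊕ lc t′ b′ → lc s u ⊕ lc r b ≡ lc (s ++ t′) (ucs ++ b′)
        regroup s r t′ eq = begin
          lc s u ⊕ lc r b                  ≡⟨ cong (lc s u ⊕_) eq ⟩
          lc s u ⊕ (lc s cs ⊕ lc t′ b′)    ≡⟨ ⊕-assoc (lc s u) (lc s cs) _ ⟨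
          (lc s u ⊕ lc s cs) ⊕ lc t′ b′    ≡⟨ cong (_⊕ lc t′ b′) (lc-zipWith-⊕ s u cs) ⟨
          lc s ucs ⊕ lc t′ b′              ≡⟨ lc-++ s t′ ucs b′ ⟨
          lc (s ++ t′) (ucs ++ b′)         ∎

        rewrite-b : ∀ s t′ → InSpan b (lc s cs ⊕ lc t′ b′)
        rewrite-b s t′ = Q⊆b _ (+-closed _ _ (lc-closed s cs cs∈Q) (b′⊆Q _ (t′ , refl)))

      span-shift⊆ : ∀ v → InSpan (u ++ b) v → InSpan (ucs ++ b′) v
      span-shift⊆ v sp with InSpan-++⁻ u b sp
      ... | s , t , refl with Q⊆b′ (lc t b ⊝ lc s cs) (⊝-closed _ _ (b⊆Q _ (t , refl)) (lc-closed s cs cs∈Q))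
      ... | t′ , eq′ = s ++ t′ , sym (regroup s t t′ (sym (trans (cong (lc s cs ⊕_) eq′) (⊕-⊝-cancel (lc s cs) (lc t b)))))

      span-shift⊇ : ∀ v → InSpan (ucs ++ b′) v → InSpan (u ++ b) v
      span-shift⊇ v sp with InSpan-++⁻ ucs b′ sp
      ... | s , t′ , refl with rewrite-b s t′
      ... | t , eq = s ++ t , trans (lc-++ s t u b) (trans (regroup s t t′ eq) (lc-++ s t′ ucs b′))

      Independent-shift : Independent (u ++ b) → Independent b′ → Independent (ucs ++ b′)
      Independent-shift ind ind′ = kernel-trivial⇒Independent trivial
        where
        trivial : ∀ st → lc st (ucs ++ b′) ≡ 𝟎 → st ≡ 𝟎
        trivial st eq with splitAt m st
        ... | s , t′ , refl with rewrite-b s t′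
        ... | r , eqr = trans (cong₂ _++_ s≡𝟎 t′≡𝟎) (𝟎-++-𝟎 {m})
          where
          s≡𝟎 : s ≡ 𝟎
          s≡𝟎 = proj₁ (Independent-++ ind s r 𝟎 𝟎 (trans (regroup s r t′ eqr)
                  (trans eq (sym (trans (cong₂ _⊕_ (lc-𝟎 u) (lc-𝟎 b)) (⊕-identityˡ 𝟎))))))
          t′≡𝟎 : t′ ≡ 𝟎
          t′≡𝟎 = ind′ t′ 𝟎 (begin
            lc t′ b′                   ≡⟨ lc-𝟎-++ t′ ucs b′ ⟨
            lc (𝟎 ++ t′) (ucs ++ b′)   ≡⟨ cong (λ z → lc (z ++ t′) (ucs ++ b′)) s≡𝟎 ⟨
            lc (s ++ t′) (ucs ++ b′)   ≡⟨ eq ⟩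
            𝟎                          ≡⟨ lc-𝟎 b′ ⟨
            lc 𝟎 b′                    ∎)
          𝟎-++-𝟎 : ∀ {m d} → 𝟎 {m} ++ 𝟎 {d} ≡ 𝟎
          𝟎-++-𝟎 {zero}  = refl
          𝟎-++-𝟎 {suc m} = cong (0# ∷_) (𝟎-++-𝟎 {m})

      shift-disjoint : Independent (ucs ++ b′) → ∀ x → Q x → InSpan ucs x → x ≡ 𝟎
      shift-disjoint ind x x∈Q (s , eq₁) with Q⊆b′ x x∈Q
      ... | t , eq₂ = trans (sym eq₁)
        (trans (cong (λ r → lc r ucs) (Independent-++-disjoint ind s t (trans eq₁ (sym eq₂)))) (lc-𝟎 ucs))

      shift-decompose : ∀ x → InSpan (u ++ b) x → ∃ λ v → ∃ λ a → Q v × InSpan ucs a × x ≡ v ⊕ a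
      shift-decompose x x∈ with InSpan-++⁻ ucs b′ (span-shift⊆ x x∈)
      ... | s , t , eq = lc t b′ , lc s ucs , b′⊆Q _ (t , refl) , (s , refl) , trans (sym eq) (⊕-comm _ _)

  module ImageBasis {n} {Q R : Pred F {n}} (SQ : IsSubspace F Q) (SR : IsSubspace F R) {g : Vector n → Vector n}
                    (iso : IsLinIso F Q R g) {d} (b : Vec (Vector n) d) (ind : Independent b)
                    (b∈Q : All Q b) (Q⊆b : ∀ v → Q v → InSpan b v) where
    open IsLinIso iso

    image-lc : ∀ t → g (lc t b) ≡ lc t (map g b)
    image-lc t = LinearMap.map-lc SQ iso t b b∈Q

    image-independent : Independent (map g b)
    image-independent t s eq = ind t s (inj _ _ (Subspace.lc-closed SQ t b b∈Q) (Subspace.lc-closed SQ s b b∈Q)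
      (trans (image-lc t) (trans eq (sym (image-lc s)))))

    image-spans : ∀ v → R v → InSpan (map g b) v
    image-spans v rv with surj v rv
    ... | x , qx , refl with Q⊆b x qx
    ... | t , refl = t , sym (image-lc t)

    span-image⊆ : ∀ v → InSpan (map g b) v → R v
    span-image⊆ v (t , refl) = Subspace.lc-closed SR t (map g b) (map⁺ (All.map (mapsTo _) b∈Q))

  span-dim-unique : ∀ {n d d′} {e : Vec (Vector n) d} {f : Vec (Vector n) d′} → Independent e → Independent f →
    (∀ v → InSpan e v → InSpan f v) → (∀ v → InSpan f v → InSpan e v) → d ≡ d′
  span-dim-unique {d = d} {d′} {e} {f} inde indf e⊆f f⊆e =
    Powers.^-injective q 2≤q d d′ (Enumeration-size-unique (span-size e inde) (span-size f indf) e⊆f f⊆e)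

  record Completion {n k} (P : Pred F {n}) (b : Vec (Vector n) k) : Set where
    field
      {m}         : ℕ
      u           : Vec (Vector n) m
      independent-u++b : Independent (u ++ b)
      u∈P              : All P u
      P⊆span-u++b      : ∀ v → P v → InSpan (u ++ b) v

  -- Greedily adjoin to b the vectors of a basis of P that are not yet in the span.
  completion : ∀ {n k d} {P : Pred F {n}} {b : Vec (Vector n) k} → HasDim F P d →
    Independent b → Completion P b
  completion {n} {P = P} {b} hd indb = record
    { u = u′ ; independent-u++b = independent′ ; u∈P = u∈P′
    ; P⊆span-u++b = λ v pv → let (t , eq) = basis-spans v pv in
        subst (InSpan (u′ ++ b)) eq (Subspace.lc-closed (span-isSubspace (u′ ++ b)) t basis covers) }
    where
    open Basis hd

    record Partial {m j} (u : Vec (Vector n) m) (cs : Vec (Vector n) j) : Set where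
      field
        {m′}         : ℕ
        u′           : Vec (Vector n) m′
        independent′ : Independent (u′ ++ b)
        u∈P′         : All P u′
        span-mono    : ∀ x → InSpan (u ++ b) x → InSpan (u′ ++ b) x
        covers       : All (InSpan (u′ ++ b)) cs

    greedy : ∀ {m j} (u : Vec (Vector n) m) → Independent (u ++ b) → All P u →
      (cs : Vec (Vector n) j) → All P cs → Partial u cs
    greedy u ind u∈P [] [] = record
      { u′ = u ; independent′ = ind ; u∈P′ = u∈P ; span-mono = λ _ z → z ; covers = [] }
    greedy u ind u∈P (c ∷ cs) (c∈P ∷ cs∈P) with InSpan? (u ++ b) c
    ... | yes c∈ = record
      { u′ = u′ ; independent′ = independent′ ; u∈P′ = u∈P′ ; span-mono = span-mono
      ; covers = span-mono c c∈ ∷ covers }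
      where open Partial (greedy u ind u∈P cs cs∈P)
    ... | no c∉ = record
      { u′ = u′ ; independent′ = independent′ ; u∈P′ = u∈P′
      ; span-mono = λ x x∈ → span-mono x (InSpan-∷ x x∈)
      ; covers    = span-mono c (unit fzero , lc-unit fzero (c ∷ (u ++ b))) ∷ covers }
      where
      open Partial (greedy (c ∷ u) (Independent-∷ ind c∉) (c∈P ∷ u∈P) cs cs∈P)
      InSpan-∷ : ∀ x → InSpan (u ++ b) x → InSpan (c ∷ (u ++ b)) x
      InSpan-∷ x (t , eq) = 0# ∷ t , trans (cong (_⊕ lc t (u ++ b)) (⊙-zeroˡ c)) (trans (⊕-identityˡ _) eq)

    open Partial (greedy [] indb [] basis basis-∈)

  HasDim-image : ∀ {n d} {Q R : Pred F {n}} {g : Vector n → Vector n} → HasDim F Q d → IsSubspace F R →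
    IsLinIso F Q R g → HasDim F R d
  HasDim-image {d = d} {R = R} {g} hd SR iso = transport (span-hasDim (map g basis) image-independent)
    where
    open Basis hd
    open ImageBasis (proj₁ hd) SR iso basis basis-independent basis-∈ basis-spans
    transport : HasDim F (InSpan (map g basis)) d → HasDim F R d
    transport (_ , b′ , b′∈ , b′-independent , b′-spans) =
      SR , b′ , (λ i → span-image⊆ _ (b′∈ i)) , b′-independent , λ v v∈R → b′-spans v (image-spans v v∈R)

module Defect (F : FiniteField) {n : ℕ} (P : PartialIso F {n}) where

  open import Data.Nat as ℕ using (_^_; _∸_)
  open import Data.Vec using (Vec; map)
  open import Data.Vec.Relation.Unary.All.Properties using (map⁺)
  open import Data.Vec.Relation.Unary.All as All using (All)
  open import Data.Product using (Σ; ∃; _×_; _,_; proj₁; proj₂)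
  open import Relation.Binary.PropositionalEquality
  open import Relation.Nullary using (Dec)
  open import Relation.Nullary.Decidable using (_×-dec_)

  open Counting
  open VectorAlgebra F
  open Span F

  open ≡-Reasoning
  open PartialIso P public
  open Powers q 2≤q using (*-q^-cancel)
  module I₁ = IsLinIso iso₁
  module I₂ = IsLinIso iso₂
  module V-sub = Subspace (proj₁ dimV)
  module W-sub = Subspace (proj₁ dimW)
  module g₁-linear = LinearMap (proj₁ dimV) iso₁
  module g₂-linear = LinearMap (proj₁ dimW) iso₂

  k : ℕ
  k = degree

  open Basis dimW public
    renaming (basis to bW; basis-independent to bW-independent; basis-spans to W⊆span-bW;
              span-basis⊆ to span-bW⊆W; basis-∈ to bW∈W)

  bV : Vec (Vector n) k
  bV = map g₂ bW

  bV∈V : All V bV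
  bV∈V = map⁺ (All.map (I₂.mapsTo _) bW∈W)

  lc-bV : ∀ t → lc t bV ≡ g₂ (lc t bW)
  lc-bV t = sym (g₂-linear.map-lc t bW bW∈W)

  bV-independent : Independent bV
  bV-independent t s eq = bW-independent t s (I₂.inj _ _ (W-sub.lc-closed t bW bW∈W) (W-sub.lc-closed s bW bW∈W)
    (trans (sym (lc-bV t)) (trans eq (lc-bV s))))

  V⊆span-bV : ∀ v → V v → InSpan bV v
  V⊆span-bV v v∈V = proj₁ t , trans (lc-bV (proj₁ t)) (trans (cong g₂ (proj₂ t)) (proj₂ (proj₂ w)))
    where
    w = I₂.surj v v∈V
    t = W⊆span-bW (proj₁ w) (proj₁ (proj₂ w))

  span-bV⊆V : ∀ v → InSpan bV v → V v
  span-bV⊆V v (t , refl) = V-sub.lc-closed t bV bV∈V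

  g₂g₁ : Vector n → Vector n
  g₂g₁ v = g₂ (g₁ v)

  g₂g₁-⊕ : ∀ x y → V x → V y → g₂g₁ (x ⊕ y) ≡ g₂g₁ x ⊕ g₂g₁ y
  g₂g₁-⊕ x y x∈V y∈V = trans (cong g₂ (I₁.additive x y x∈V y∈V)) (I₂.additive _ _ (I₁.mapsTo x x∈V) (I₁.mapsTo y y∈V))

  g₂g₁-⊝ : ∀ x y → V x → V y → g₂g₁ (x ⊝ y) ≡ g₂g₁ x ⊝ g₂g₁ y
  g₂g₁-⊝ x y x∈V y∈V = trans (cong g₂ (g₁-linear.map-⊝ x y x∈V y∈V)) (g₂-linear.map-⊝ _ _ (I₁.mapsTo x x∈V) (I₁.mapsTo y y∈V))

  g₂g₁-⊖ : ∀ x → V x → g₂g₁ (⊖ x) ≡ ⊖ (g₂g₁ x)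
  g₂g₁-⊖ x x∈V = trans (cong g₂ (g₁-linear.map-⊖ x x∈V)) (g₂-linear.map-⊖ _ (I₁.mapsTo x x∈V))

  defect : Vector n → Vector n
  defect v = v ⊝ g₂g₁ v

  defect-∈V : ∀ {v} → V v → V (defect v)
  defect-∈V v∈V = V-sub.⊝-closed _ _ v∈V (I₂.mapsTo _ (I₁.mapsTo _ v∈V))

  defect-⊕ : ∀ x y → V x → V y → defect (x ⊕ y) ≡ defect x ⊕ defect y
  defect-⊕ x y x∈V y∈V = trans (cong ((x ⊕ y) ⊝_) (g₂g₁-⊕ x y x∈V y∈V)) (⊕-⊝-interchange x y (g₂g₁ x) (g₂g₁ y))

  defect-⊝ : ∀ x y → V x → V y → defect (x ⊝ y) ≡ defect x ⊝ defect y
  defect-⊝ x y x∈V y∈V = trans (cong ((x ⊝ y) ⊝_) (g₂g₁-⊝ x y x∈V y∈V)) (⊝-⊝-interchange x y (g₂g₁ x) (g₂g₁ y))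

  DefectImage : Vector n → Set
  DefectImage y = Σ (Vec K k) λ t → defect (lc t bV) ≡ y

  DefectImage? : ∀ y → Dec (DefectImage y)
  DefectImage? y = Σ? (coefficients k) (λ t → defect (lc t bV) ≟ y)

  DefectImage-finite : Σ ℕ (Enumeration DefectImage)
  DefectImage-finite = _ , Enumeration-filter (coefficients n) DefectImage?

  #DefectImage : ℕ
  #DefectImage = proj₁ DefectImage-finite

  -- The corrections c ∈ W allowed in a trivial extension.
  Admissible : Vector n → Set
  Admissible c = InSpan bW c × DefectImage (g₂ c)

  Admissible-size-#DefectImage : Enumeration Admissible #DefectImage
  Admissible-size-#DefectImage = subst (Enumeration Admissible)
    (Enumeration-size-unique (Enumeration-map g₂ (λ _ → proj₂) g₂-injective preimage E)
      (proj₂ DefectImage-finite) (λ _ z → z) (λ _ z → z)) E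
    where
    E = Enumeration-filter (coefficients n) (λ c → InSpan? bW c ×-dec DefectImage? (g₂ c))
    g₂-injective : ∀ x y → Admissible x → Admissible y → g₂ x ≡ g₂ y → x ≡ y
    g₂-injective x y x∈ y∈ = I₂.inj x y (span-bW⊆W x (proj₁ x∈)) (span-bW⊆W y (proj₁ y∈))
    preimage : ∀ y → DefectImage y → ∃ λ c → Admissible c × g₂ c ≡ y
    preimage y (t , eq) = proj₁ c , (W⊆span-bW _ (proj₁ (proj₂ c)) , t , trans eq (sym (proj₂ (proj₂ c)))) , proj₂ (proj₂ c)
      where c = I₂.surj y (subst V eq (defect-∈V (span-bV⊆V _ (t , refl))))

  -- The defect witness is − g₂ w.
  admissible-g₁g₂-⊝ : ∀ w → W w → Admissible (g₁ (g₂ w) ⊝ w)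
  admissible-g₁g₂-⊝ w w∈W =
    W⊆span-bW _ (W-sub.⊝-closed y w y∈W w∈W) , proj₁ d∈span , trans (cong defect (proj₂ d∈span)) defect-d≡g₂c
    where
    y = g₁ (g₂ w)
    g₂w∈V : V (g₂ w)
    g₂w∈V = I₂.mapsTo w w∈W
    y∈W : W y
    y∈W = I₁.mapsTo _ g₂w∈V
    d = ⊖ (g₂ w)
    d∈span : InSpan bV d
    d∈span = V⊆span-bV d (V-sub.⊖-closed _ g₂w∈V)
    defect-d≡g₂c : defect d ≡ g₂ (y ⊝ w)
    defect-d≡g₂c = begin
      d ⊝ g₂g₁ d                  ≡⟨ cong (λ z → d ⊕ ⊖ z) (g₂g₁-⊖ _ g₂w∈V) ⟩
      d ⊕ ⊖ (⊖ (g₂g₁ (g₂ w)))     ≡⟨ cong (d ⊕_) (⊖-involutive _) ⟩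
      ⊖ (g₂ w) ⊕ g₂g₁ (g₂ w)      ≡⟨ ⊕-comm _ _ ⟩
      g₂ y ⊝ g₂ w                 ≡⟨ g₂-linear.map-⊝ y w y∈W w∈W ⟨
      g₂ (y ⊝ w)                  ∎

  -- Rank–nullity for the defect: each fibre over its image is a translate of Fix F P.
  #DefectImage-rank-nullity : ∀ {k₁} → HasDim F (Fix F P) k₁ → #DefectImage ℕ.* q ^ k₁ ≡ q ^ k
  #DefectImage-rank-nullity {k₁} hFix = Enumeration-size-unique
    (Enumeration-map proj₂ (λ _ (_ , v∈ , _) → v∈) same-fibre
      (λ { v (t , eq) → (defect v , v) , ((t , cong defect eq) , (t , eq) , refl) , refl })
      (Enumeration-Σ (proj₂ DefectImage-finite) fibre-size))
    (span-size bV bV-independent) (λ _ z → z) (λ _ z → z)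
    where
    open Basis hFix renaming (basis to bF)
    same-fibre : ∀ p p′ → (DefectImage (proj₁ p) × InSpan bV (proj₂ p) × defect (proj₂ p) ≡ proj₁ p) →
      (DefectImage (proj₁ p′) × InSpan bV (proj₂ p′) × defect (proj₂ p′) ≡ proj₁ p′) → proj₂ p ≡ proj₂ p′ → p ≡ p′
    same-fibre (y , v) (y′ , .v) (_ , _ , dv≡y) (_ , _ , dv≡y′) refl = cong (_, v) (trans (sym dv≡y) dv≡y′)
    fibre-size : ∀ y → DefectImage y → Enumeration (λ v → InSpan bV v × defect v ≡ y) (q ^ k₁)
    fibre-size y (t₀ , eq₀) = Enumeration-map (v₀ ⊕_) into (λ a b _ _ → ⊕-cancelˡ v₀ a b) onto
      (span-size bF basis-independent)
      where
      v₀ = lc t₀ bV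
      v₀∈V : V v₀
      v₀∈V = span-bV⊆V _ (t₀ , refl)
      into : ∀ x → InSpan bF x → InSpan bV (v₀ ⊕ x) × defect (v₀ ⊕ x) ≡ y
      into x x∈ = V⊆span-bV _ (V-sub.+-closed v₀ x v₀∈V x∈V) , (begin
        defect (v₀ ⊕ x)          ≡⟨ defect-⊕ v₀ x v₀∈V x∈V ⟩
        defect v₀ ⊕ (x ⊝ g₂g₁ x)  ≡⟨ cong₂ (λ a b → a ⊕ (x ⊝ b)) eq₀ x-fixed ⟩
        y ⊕ (x ⊝ x)               ≡⟨ cong (y ⊕_) (⊕-inverseʳ x) ⟩
        y ⊕ 𝟎                     ≡⟨ ⊕-identityʳ y ⟩
        y                         ∎)
        where
        x∈V = proj₁ (span-basis⊆ x x∈)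
        x-fixed = proj₂ (span-basis⊆ x x∈)
      onto : ∀ v → InSpan bV v × defect v ≡ y → ∃ λ x → InSpan bF x × v₀ ⊕ x ≡ v
      onto v (v∈ , dv≡y) = v ⊝ v₀ , basis-spans _ (x∈V , sym (x⊝y≡𝟎⇒x≡y _ _ dx≡𝟎)) , ⊕-⊝-cancel v₀ v
        where
        v∈V = span-bV⊆V v v∈
        x∈V = V-sub.⊝-closed v v₀ v∈V v₀∈V
        dx≡𝟎 : defect (v ⊝ v₀) ≡ 𝟎
        dx≡𝟎 = trans (defect-⊝ v v₀ v∈V v₀∈V) (trans (cong₂ _⊝_ dv≡y eq₀) (⊕-inverseʳ y))

  admissible-size : ∀ {k₁} → HasDim F (Fix F P) k₁ → Enumeration Admissible (q ^ (k ∸ k₁))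
  admissible-size {k₁} hFix = subst (Enumeration Admissible) #DefectImage≡ Admissible-size-#DefectImage
    where
    𝟎∈DefectImage : DefectImage 𝟎
    𝟎∈DefectImage = 𝟎 , (begin
      defect (lc 𝟎 bV)  ≡⟨ cong defect (lc-𝟎 bV) ⟩
      𝟎 ⊝ g₂g₁ 𝟎        ≡⟨ cong (λ z → 𝟎 ⊝ g₂ z) g₁-linear.map-𝟎 ⟩
      𝟎 ⊝ g₂ 𝟎          ≡⟨ cong (𝟎 ⊝_) g₂-linear.map-𝟎 ⟩
      𝟎 ⊝ 𝟎             ≡⟨ ⊕-inverseʳ 𝟎 ⟩
      𝟎                 ∎)
    #DefectImage≡ : #DefectImage ≡ q ^ (k ∸ k₁)
    #DefectImage≡ = *-q^-cancel #DefectImage k k₁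
      (Fin⇒1≤ (proj₁ (Enumeration.surjective (proj₂ DefectImage-finite) 𝟎 𝟎∈DefectImage)))
      (#DefectImage-rank-nullity hFix)

module RightExtensions (F : FiniteField) {n : ℕ} (P : PartialIso F {n})
  (W⁺ : Pred F {n}) {k⁺ : ℕ} (dimW⁺ : HasDim F W⁺ k⁺) (W⊆W⁺ : _⊆_ F (PartialIso.W P) W⁺) where

  open import Data.Nat as ℕ using (zero; suc; _^_; _∸_)
  open import Data.Nat.Properties using (+-comm; *-comm; ^-*-assoc; m+n∸n≡m)
  open import Data.Vec using (Vec; []; _∷_; zipWith; map; _++_)
  open import Data.Vec.Properties using (∷-injectiveˡ; ∷-injectiveʳ; ++-injectiveˡ; map-++; map-∘)
  open import Data.Vec.Relation.Unary.All as All using (All; []; _∷_)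
  open import Data.Vec.Relation.Unary.All.Properties using (map⁺; ++⁺)
  open import Data.Product using (Σ; ∃; _×_; _,_; proj₁; proj₂)
  open import Data.Unit using (⊤; tt)
  open import Relation.Binary.PropositionalEquality
  open import Relation.Nullary using (¬_)

  open Counting
  open VectorAlgebra F
  open Span F
  open Defect F P

  open ≡-Reasoning
  module W⁺-sub = Subspace (proj₁ dimW⁺)

  open Completion (completion dimW⁺ bW-independent)
    renaming (independent-u++b to u++bW-independent; u∈P to u∈W⁺; P⊆span-u++b to W⁺⊆span)

  u++bW∈W⁺ : All W⁺ (u ++ bW)
  u++bW∈W⁺ = ++⁺ u∈W⁺ (All.map (W⊆W⁺ _) bW∈W)

  span⊆W⁺ : ∀ v → InSpan (u ++ bW) v → W⁺ v
  span⊆W⁺ v (t , refl) = W⁺-sub.lc-closed t (u ++ bW) u++bW∈W⁺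

  m+k≡k⁺ : m ℕ.+ k ≡ k⁺
  m+k≡k⁺ = span-dim-unique u++bW-independent basis-independent
    (λ v v∈ → basis-spans v (span⊆W⁺ v v∈)) (λ v v∈ → W⁺⊆span v (span-basis⊆ v v∈))
    where open Basis dimW⁺

  map-cong-All : ∀ {Q : Pred F {n}} {f g : Vector n → Vector n} {j} (e : Vec (Vector n) j) →
    All Q e → (∀ x → Q x → f x ≡ g x) → map f e ≡ map g e
  map-cong-All []      []         f≡g = refl
  map-cong-All (x ∷ e) (px ∷ pe) f≡g = cong₂ _∷_ (f≡g x px) (map-cong-All e pe f≡g)

  map-++⁻ˡ : ∀ {j d} (g : Vector n → Vector n) (xs : Vec (Vector n) j) (e ys : Vec (Vector n) d) {zs} →
    map g (xs ++ e) ≡ zs ++ ys → map g xs ≡ zs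
  map-++⁻ˡ g xs e ys eq = ++-injectiveˡ (map g xs) _ (trans (sym (map-++ g xs e)) eq)

  IndependentOverV : ∀ {j} → Vec (Vector n) j → Set
  IndependentOverV []       = ⊤
  IndependentOverV (x ∷ xs) = IndependentOverV xs × ¬ InSpan (xs ++ bV) x

  IndependentOverV⇒Independent : ∀ {j} (xs : Vec (Vector n) j) → IndependentOverV xs → Independent (xs ++ bV)
  IndependentOverV⇒Independent []       tt          = bV-independent
  IndependentOverV⇒Independent (x ∷ xs) (free , x∉) = Independent-∷ (IndependentOverV⇒Independent xs free) x∉

  module g₁bV-basis = ImageBasis (proj₁ dimV) (proj₁ dimW) iso₁ bV bV-independent bV∈V V⊆span-bV

  g₁bV : Vec (Vector n) k
  g₁bV = map g₁ bV

  module ShiftW  = Shift (proj₁ dimW) bW g₁bV W⊆span-bW span-bW⊆W g₁bV-basis.image-spans g₁bV-basis.span-image⊆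
  module ShiftV  = Shift (proj₁ dimV) bV bV V⊆span-bV span-bV⊆V V⊆span-bV span-bV⊆V
  module ShiftW′ = Shift (proj₁ dimW) g₁bV g₁bV g₁bV-basis.image-spans g₁bV-basis.span-image⊆ g₁bV-basis.image-spans g₁bV-basis.span-image⊆

  defect-witnesses : ∀ {j} {cs : Vec (Vector n) j} → All Admissible cs → Vec (Vector n) j
  defect-witnesses []                       = []
  defect-witnesses ((_ , t , _) ∷ cs-adm) = lc t bV ∷ defect-witnesses cs-adm

  defect-witnesses∈V : ∀ {j} {cs : Vec (Vector n) j} (cs-adm : All Admissible cs) → All V (defect-witnesses cs-adm)
  defect-witnesses∈V []                       = []
  defect-witnesses∈V ((_ , t , _) ∷ cs-adm) = span-bV⊆V _ (t , refl) ∷ defect-witnesses∈V cs-adm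

  -- (x + g₂ c) + g₂ g₁ d = x + d, since d − g₂ g₁ d = g₂ c.
  defect-witnesses-absorb : ∀ {j} (xs : Vec (Vector n) j) {cs} (cs-adm : All Admissible cs) →
    zipWith _⊕_ (zipWith _⊕_ xs (map g₂ cs)) (map g₂g₁ (defect-witnesses cs-adm)) ≡ zipWith _⊕_ xs (defect-witnesses cs-adm)
  defect-witnesses-absorb []       []                          = refl
  defect-witnesses-absorb (x ∷ xs) {c ∷ _} ((_ , t , eq) ∷ cs-adm) = cong₂ _∷_ (begin
    (x ⊕ g₂ c) ⊕ g₂g₁ d            ≡⟨ cong (λ z → (x ⊕ z) ⊕ g₂g₁ d) eq ⟨
    (x ⊕ (d ⊝ g₂g₁ d)) ⊕ g₂g₁ d    ≡⟨ ⊕-assoc x (d ⊝ g₂g₁ d) (g₂g₁ d) ⟩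
    x ⊕ ((d ⊝ g₂g₁ d) ⊕ g₂g₁ d)    ≡⟨ cong (x ⊕_) (⊝-⊕-cancel (g₂g₁ d) d) ⟩
    x ⊕ d                           ∎) (defect-witnesses-absorb xs cs-adm)
    where d = lc t bV

  -- The maps of the trivial extension with g₂⁺ u = xs and g₁⁺ xs = u + cs.
  extension-g₁ : Vec (Vector n) m → Vec (Vector n) m → Vector n → Vector n
  extension-g₁ cs xs = linearExtension (xs ++ bV) (zipWith _⊕_ u cs ++ g₁bV)

  extension-g₂ : Vec (Vector n) m → Vector n → Vector n
  extension-g₂ xs = linearExtension (u ++ bW) (xs ++ bV)

  module Construction {cs xs : Vec (Vector n) m} (cs-adm : All Admissible cs) (xs-free : IndependentOverV xs) where

    u+cs : Vec (Vector n) m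
    u+cs = zipWith _⊕_ u cs

    g₁⁺ g₂⁺ : Vector n → Vector n
    g₁⁺ = extension-g₁ cs xs
    g₂⁺ = extension-g₂ xs

    xs++bV-independent : Independent (xs ++ bV)
    xs++bV-independent = IndependentOverV⇒Independent xs xs-free

    cs∈W : All W cs
    cs∈W = All.map (λ (c∈ , _) → span-bW⊆W _ c∈) cs-adm

    W⁺⊆span-image : ∀ v → W⁺ v → InSpan (u+cs ++ g₁bV) v
    W⁺⊆span-image v v∈ = ShiftW.span-shift⊆ u cs cs∈W v (W⁺⊆span v v∈)

    span-image⊆W⁺ : ∀ v → InSpan (u+cs ++ g₁bV) v → W⁺ v
    span-image⊆W⁺ v v∈ = span⊆W⁺ v (ShiftW.span-shift⊇ u cs cs∈W v v∈)

    image-independent : Independent (u+cs ++ g₁bV)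
    image-independent = ShiftW.Independent-shift u cs cs∈W u++bW-independent g₁bV-basis.image-independent

    g₁⁺-isLinIso : IsLinIso F (InSpan (xs ++ bV)) W⁺ g₁⁺
    g₁⁺-isLinIso = linearExtension-isLinIso xs++bV-independent image-independent _ W⁺
      (λ _ z → z) (λ _ z → z) W⁺⊆span-image span-image⊆W⁺

    g₂⁺-isLinIso : IsLinIso F W⁺ (InSpan (xs ++ bV)) g₂⁺
    g₂⁺-isLinIso = linearExtension-isLinIso u++bW-independent xs++bV-independent W⁺ _
      W⁺⊆span span⊆W⁺ (λ _ z → z) (λ _ z → z)

    module G₁⁺ = IsLinIso g₁⁺-isLinIso
    module G₂⁺-linear = LinearMap (proj₁ dimW⁺) g₂⁺-isLinIso

    extension : PartialIso F {n}
    extension = record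
      { V = InSpan (xs ++ bV) ; W = W⁺ ; g₁ = g₁⁺ ; g₂ = g₂⁺ ; degree = m ℕ.+ k
      ; dimV = span-hasDim (xs ++ bV) xs++bV-independent ; dimW = subst (HasDim F W⁺) (sym m+k≡k⁺) dimW⁺
      ; iso₁ = g₁⁺-isLinIso ; iso₂ = g₂⁺-isLinIso }

    V⊆V⁺ : ∀ v → V v → InSpan (xs ++ bV) v
    V⊆V⁺ v v∈ = InSpan-++ʳ xs (V⊆span-bV v v∈)

    g₁⁺-extends : ∀ v → V v → g₁⁺ v ≡ g₁ v
    g₁⁺-extends v v∈ = subst (λ w → g₁⁺ w ≡ g₁ w) (proj₂ (V⊆span-bV v v∈))
      (trans (linearExtension-++ʳ xs++bV-independent t) (sym (g₁bV-basis.image-lc t)))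
      where t = proj₁ (V⊆span-bV v v∈)

    g₂⁺-extends : ∀ w → W w → g₂⁺ w ≡ g₂ w
    g₂⁺-extends w w∈ = subst (λ v → g₂⁺ v ≡ g₂ v) (proj₂ (W⊆span-bW w w∈))
      (trans (linearExtension-++ʳ u++bW-independent t) (lc-bV t))
      where t = proj₁ (W⊆span-bW w w∈)

    isExtension : IsExtension F P extension
    isExtension = V⊆V⁺ , W⊆W⁺ , g₁⁺-extends , g₂⁺-extends

    ds : Vec (Vector n) m
    ds = defect-witnesses cs-adm

    ds∈V : All V ds
    ds∈V = defect-witnesses∈V cs-adm

    g₁ds∈W : All W (map g₁ ds)
    g₁ds∈W = map⁺ (All.map (I₁.mapsTo _) ds∈V)

    -- A = span as and B = span bs are the complements of V in V⁺ and of W in W⁺.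
    as bs : Vec (Vector n) m
    as = zipWith _⊕_ xs ds
    bs = zipWith _⊕_ u+cs (map g₁ ds)

    xs∈V⁺ : All (InSpan (xs ++ bV)) xs
    xs∈V⁺ = All.map (InSpan-++ˡ bV) (span-∋ xs)

    as∈V⁺ : All (InSpan (xs ++ bV)) as
    as∈V⁺ = Subspace.zipWith-⊕-closed (span-isSubspace (xs ++ bV)) xs∈V⁺ (All.map (V⊆V⁺ _) ds∈V)

    u+cs∈W⁺ : All W⁺ u+cs
    u+cs∈W⁺ = W⁺-sub.zipWith-⊕-closed u∈W⁺ (All.map (W⊆W⁺ _) cs∈W)

    bs∈W⁺ : All W⁺ bs
    bs∈W⁺ = W⁺-sub.zipWith-⊕-closed u+cs∈W⁺ (All.map (W⊆W⁺ _) g₁ds∈W)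

    as++bV-independent : Independent (as ++ bV)
    as++bV-independent = ShiftV.Independent-shift xs ds ds∈V xs++bV-independent bV-independent

    bs++g₁bV-independent : Independent (bs ++ g₁bV)
    bs++g₁bV-independent = ShiftW′.Independent-shift u+cs (map g₁ ds) g₁ds∈W image-independent g₁bV-basis.image-independent

    A⊆V⁺ : ∀ v → InSpan as v → InSpan (xs ++ bV) v
    A⊆V⁺ v v∈ = ShiftV.span-shift⊇ xs ds ds∈V v (InSpan-++ˡ bV v∈)

    B⊆W⁺ : ∀ v → InSpan bs v → W⁺ v
    B⊆W⁺ v v∈ = span-image⊆W⁺ v (ShiftW′.span-shift⊇ u+cs (map g₁ ds) g₁ds∈W v (InSpan-++ˡ g₁bV v∈))

    V∩A≡𝟎 : ∀ x → V x → InSpan as x → x ≡ 𝟎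
    V∩A≡𝟎 = ShiftV.shift-disjoint xs ds ds∈V as++bV-independent

    W∩B≡𝟎 : ∀ x → W x → InSpan bs x → x ≡ 𝟎
    W∩B≡𝟎 = ShiftW′.shift-disjoint u+cs (map g₁ ds) g₁ds∈W bs++g₁bV-independent

    V⁺≡V+A : ∀ x → InSpan (xs ++ bV) x → ∃ λ v → ∃ λ a → V v × InSpan as a × x ≡ v ⊕ a
    V⁺≡V+A = ShiftV.shift-decompose xs ds ds∈V

    W⁺≡W+B : ∀ x → W⁺ x → ∃ λ w → ∃ λ b → W w × InSpan bs b × x ≡ w ⊕ b
    W⁺≡W+B x x∈ = ShiftW′.shift-decompose u+cs (map g₁ ds) g₁ds∈W x (W⁺⊆span-image x x∈)

    map-g₁⁺-as : map g₁⁺ as ≡ bs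
    map-g₁⁺-as = trans (LinearMap.map-zipWith-⊕ (span-isSubspace (xs ++ bV)) g₁⁺-isLinIso xs ds xs∈V⁺ (All.map (V⊆V⁺ _) ds∈V))
      (cong₂ (zipWith _⊕_) (map-++⁻ˡ g₁⁺ xs bV g₁bV (map-linearExtension xs++bV-independent))
                           (map-cong-All ds ds∈V g₁⁺-extends))

    map-g₂⁺-bs : map g₂⁺ bs ≡ as
    map-g₂⁺-bs = begin
      map g₂⁺ bs
        ≡⟨ G₂⁺-linear.map-zipWith-⊕ u+cs (map g₁ ds) u+cs∈W⁺ (All.map (W⊆W⁺ _) g₁ds∈W) ⟩
      zipWith _⊕_ (map g₂⁺ u+cs) (map g₂⁺ (map g₁ ds))
        ≡⟨ cong₂ (zipWith _⊕_) (G₂⁺-linear.map-zipWith-⊕ u cs u∈W⁺ (All.map (W⊆W⁺ _) cs∈W)) (map-cong-All _ g₁ds∈W g₂⁺-extends) ⟩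
      zipWith _⊕_ (zipWith _⊕_ (map g₂⁺ u) (map g₂⁺ cs)) (map g₂ (map g₁ ds))
        ≡⟨ cong₂ (λ a b → zipWith _⊕_ (zipWith _⊕_ a b) (map g₂ (map g₁ ds)))
             (map-++⁻ˡ g₂⁺ u bW bV (map-linearExtension u++bW-independent)) (map-cong-All cs cs∈W g₂⁺-extends) ⟩
      zipWith _⊕_ (zipWith _⊕_ xs (map g₂ cs)) (map g₂ (map g₁ ds))
        ≡⟨ cong (zipWith _⊕_ (zipWith _⊕_ xs (map g₂ cs))) (map-∘ g₂ g₁ ds) ⟨
      zipWith _⊕_ (zipWith _⊕_ xs (map g₂ cs)) (map g₂g₁ ds)
        ≡⟨ defect-witnesses-absorb xs cs-adm ⟩
      as ∎

    g₁⁺-lc-as : ∀ s → g₁⁺ (lc s as) ≡ lc s bs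
    g₁⁺-lc-as s = trans (LinearMap.map-lc (span-isSubspace (xs ++ bV)) g₁⁺-isLinIso s as as∈V⁺) (cong (lc s) map-g₁⁺-as)

    g₂⁺-lc-bs : ∀ s → g₂⁺ (lc s bs) ≡ lc s as
    g₂⁺-lc-bs s = trans (G₂⁺-linear.map-lc s bs bs∈W⁺) (cong (lc s) map-g₂⁺-bs)

    ψ-isLinIso : IsLinIso F (InSpan as) (InSpan bs) g₁⁺
    ψ-isLinIso = record
      { mapsTo   = λ x (s , eq) → s , trans (sym (g₁⁺-lc-as s)) (cong g₁⁺ eq)
      ; additive = λ x y x∈ y∈ → G₁⁺.additive x y (A⊆V⁺ x x∈) (A⊆V⁺ y y∈)
      ; homog    = λ c x x∈ → G₁⁺.homog c x (A⊆V⁺ x x∈)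
      ; inj      = λ x y x∈ y∈ → G₁⁺.inj x y (A⊆V⁺ x x∈) (A⊆V⁺ y y∈)
      ; surj     = λ y (s , eq) → lc s as , (s , refl) , trans (g₁⁺-lc-as s) eq }

    isTrivial : IsTrivial F P extension
    isTrivial = InSpan as , InSpan bs , g₁⁺ , span-isSubspace as , span-isSubspace bs ,
      A⊆V⁺ , V∩A≡𝟎 , V⁺≡V+A , B⊆W⁺ , W∩B≡𝟎 , W⁺≡W+B , ψ-isLinIso , (λ _ _ → refl) ,
      (λ a (s , eq) → subst (λ z → g₂⁺ (g₁⁺ z) ≡ z) eq (trans (cong g₂⁺ (g₁⁺-lc-as s)) (g₂⁺-lc-bs s)))

    trivialExtension : TrivExtRight F P W⁺
    trivialExtension = extension , isExtension , isTrivial , (λ _ → (λ z → z) , (λ z → z))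

  Valid : Vec (Vector n) m × Vec (Vector n) m → Set
  Valid (cs , xs) = All Admissible cs × IndependentOverV xs

  construct : ∀ p → Valid p → TrivExtRight F P W⁺
  construct (cs , xs) (cs-adm , xs-free) = Construction.trivialExtension {cs} {xs} cs-adm xs-free

  Same : TrivExtRight F P W⁺ → TrivExtRight F P W⁺ → Set
  Same = SameExt F {n} {TrivExtRight F P W⁺} proj₁

  Same-trans : ∀ {a b c} → Same a b → Same b c → Same a c
  Same-trans (v₁ , w₁ , g₁≡ , g₂≡) (v₂ , w₂ , h₁≡ , h₂≡) =
    (λ v → (λ z → proj₁ (v₂ v) (proj₁ (v₁ v) z)) , (λ z → proj₂ (v₁ v) (proj₂ (v₂ v) z))) ,
    (λ w → (λ z → proj₁ (w₂ w) (proj₁ (w₁ w) z)) , (λ z → proj₂ (w₁ w) (proj₂ (w₂ w) z))) ,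
    (λ v v∈ → trans (g₁≡ v v∈) (h₁≡ v (proj₁ (v₁ v) v∈))) ,
    (λ w w∈ → trans (g₂≡ w w∈) (h₂≡ w (proj₁ (w₁ w) w∈)))

  -- The construction does not depend on the defect witnesses inside the validity proof.
  construct-irrelevant : ∀ p valid valid′ → Same (construct p valid) (construct p valid′)
  construct-irrelevant _ _ _ = (λ _ → (λ z → z) , (λ z → z)) , (λ _ → (λ z → z) , (λ z → z)) , (λ _ _ → refl) , (λ _ _ → refl)

  zipWith-⊕-cancelˡ : ∀ {j} (u′ cs cs′ : Vec (Vector n) j) → zipWith _⊕_ u′ cs ≡ zipWith _⊕_ u′ cs′ → cs ≡ cs′
  zipWith-⊕-cancelˡ []       []       []         _  = refl
  zipWith-⊕-cancelˡ (x ∷ u′) (c ∷ cs) (c′ ∷ cs′) eq =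
    cong₂ _∷_ (⊕-cancelˡ x c c′ (∷-injectiveˡ eq)) (zipWith-⊕-cancelˡ u′ cs cs′ (∷-injectiveʳ eq))

  -- The data is read back off g₂⁺ u = xs and g₁⁺ xs = u + cs.
  construct-injective : ∀ p p′ valid valid′ → Same (construct p valid) (construct p′ valid′) → p ≡ p′
  construct-injective (cs , xs) (cs′ , xs′) (cs-adm , xs-free) (cs′-adm , xs′-free) (_ , _ , g₁⁺≡ , g₂⁺≡) =
    cong₂ _,_ (zipWith-⊕-cancelˡ u cs cs′ u+cs≡) xs≡
    where
    xs≡ : xs ≡ xs′
    xs≡ = begin
      xs                          ≡⟨ map-++⁻ˡ (extension-g₂ xs) u bW bV (map-linearExtension u++bW-independent) ⟨
      map (extension-g₂ xs) u     ≡⟨ map-cong-All u u∈W⁺ g₂⁺≡ ⟩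
      map (extension-g₂ xs′) u    ≡⟨ map-++⁻ˡ (extension-g₂ xs′) u bW bV (map-linearExtension u++bW-independent) ⟩
      xs′                         ∎
    u+cs≡ : zipWith _⊕_ u cs ≡ zipWith _⊕_ u cs′
    u+cs≡ = begin
      zipWith _⊕_ u cs               ≡⟨ map-++⁻ˡ (extension-g₁ cs xs) xs bV g₁bV
                                          (map-linearExtension (IndependentOverV⇒Independent xs xs-free)) ⟨
      map (extension-g₁ cs xs) xs    ≡⟨ map-cong-All xs (All.map (InSpan-++ˡ bV) (span-∋ xs)) g₁⁺≡ ⟩
      map (extension-g₁ cs′ xs′) xs  ≡⟨ cong (map (extension-g₁ cs′ xs′)) xs≡ ⟩
      map (extension-g₁ cs′ xs′) xs′ ≡⟨ map-++⁻ˡ (extension-g₁ cs′ xs′) xs′ bV g₁bV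
                                          (map-linearExtension (IndependentOverV⇒Independent xs′ xs′-free)) ⟩
      zipWith _⊕_ u cs′              ∎

  module Decomposition {E : PartialIso F {n}} (isExt : IsExtension F P E) (isTriv : IsTrivial F P E)
                       (W-E⇔W⁺ : ∀ w → (PartialIso.W E w → W⁺ w) × (W⁺ w → PartialIso.W E w)) where
    module E  = PartialIso E
    module J₁ = IsLinIso E.iso₁
    module J₂ = IsLinIso E.iso₂

    V⊆V-E : ∀ v → V v → E.V v
    V⊆V-E = proj₁ isExt
    W⊆W-E : ∀ w → W w → E.W w
    W⊆W-E = proj₁ (proj₂ isExt)
    g₁-E-extends : ∀ v → V v → E.g₁ v ≡ g₁ v
    g₁-E-extends = proj₁ (proj₂ (proj₂ isExt))
    g₂-E-extends : ∀ w → W w → E.g₂ w ≡ g₂ w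
    g₂-E-extends = proj₂ (proj₂ (proj₂ isExt))
    W⁺⊆W-E : ∀ w → W⁺ w → E.W w
    W⁺⊆W-E w = proj₂ (W-E⇔W⁺ w)

    xs : Vec (Vector n) m
    xs = map E.g₂ u

    cs : Vec (Vector n) m
    cs = zipWith _⊝_ (map E.g₁ xs) u

    g₂-E-lc : ∀ {j} (t : Vec K j) e → All W⁺ e → E.g₂ (lc t e) ≡ lc t (map E.g₂ e)
    g₂-E-lc t e e∈ = LinearMap.map-lc (proj₁ E.dimW) E.iso₂ t e (All.map (W⁺⊆W-E _) e∈)

    map-g₂-E-u++bW : map E.g₂ (u ++ bW) ≡ xs ++ bV
    map-g₂-E-u++bW = trans (map-++ E.g₂ u bW) (cong (xs ++_) (map-cong-All bW bW∈W g₂-E-extends))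

    g₂-E-lc-u++bW : ∀ t → E.g₂ (lc t (u ++ bW)) ≡ lc t (xs ++ bV)
    g₂-E-lc-u++bW t = trans (g₂-E-lc t (u ++ bW) u++bW∈W⁺) (cong (lc t) map-g₂-E-u++bW)

    xs-free : ∀ {j} (u′ : Vec (Vector n) j) → Independent (u′ ++ bW) → All W⁺ u′ → IndependentOverV (map E.g₂ u′)
    xs-free []       _   _            = tt
    xs-free (c ∷ u′) ind (c∈ ∷ u′∈) = xs-free u′ (Independent-tail ind) u′∈ , g₂c∉
      where
      u′++bW∈W⁺ : All W⁺ (u′ ++ bW)
      u′++bW∈W⁺ = ++⁺ u′∈ (All.map (W⊆W⁺ _) bW∈W)
      g₂c∉ : ¬ InSpan (map E.g₂ u′ ++ bV) (E.g₂ c)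
      g₂c∉ (t , eq) = Independent-head ind (t , J₂.inj _ _ (W⁺⊆W-E _ (W⁺-sub.lc-closed t _ u′++bW∈W⁺)) (W⁺⊆W-E c c∈)
        (begin
          E.g₂ (lc t (u′ ++ bW))        ≡⟨ g₂-E-lc t (u′ ++ bW) u′++bW∈W⁺ ⟩
          lc t (map E.g₂ (u′ ++ bW))    ≡⟨ cong (lc t) (trans (map-++ E.g₂ u′ bW) (cong (map E.g₂ u′ ++_) (map-cong-All bW bW∈W g₂-E-extends))) ⟩
          lc t (map E.g₂ u′ ++ bV)      ≡⟨ eq ⟩
          E.g₂ c                        ∎))

    -- Write x = w + ψ a with w ∈ W and a ∈ A; then g₁ᴱ g₂ᴱ x − x = g₁ g₂ w − w.
    correction-admissible : IsTrivial F P E → ∀ x → W⁺ x → Admissible (E.g₁ (E.g₂ x) ⊝ x)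
    correction-admissible (A , B , ψ , _ , _ , A⊆V-E , _ , _ , B⊆W-E , _ , W-E≡W+B , ψ-iso , g₁-E≡ψ , g₂-E∘ψ≡id) x x∈ =
      subst (λ z → Admissible (E.g₁ (E.g₂ z) ⊝ z)) (sym x≡w⊕ψa) (admissible (proj₁ x-split) (proj₁ b-preimage) w∈W a∈A)
      where
      x-split = W-E≡W+B x (W⁺⊆W-E x x∈)
      w∈W = proj₁ (proj₂ (proj₂ x-split))
      b∈B = proj₁ (proj₂ (proj₂ (proj₂ x-split)))
      b-preimage = IsLinIso.surj ψ-iso _ b∈B
      a∈A = proj₁ (proj₂ b-preimage)
      x≡w⊕ψa : x ≡ proj₁ x-split ⊕ ψ (proj₁ b-preimage)
      x≡w⊕ψa = trans (proj₂ (proj₂ (proj₂ (proj₂ x-split)))) (cong (proj₁ x-split ⊕_) (sym (proj₂ (proj₂ b-preimage))))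
      admissible : ∀ w a → W w → A a → Admissible (E.g₁ (E.g₂ (w ⊕ ψ a)) ⊝ (w ⊕ ψ a))
      admissible w a w∈W a∈A = subst Admissible (sym c≡) (admissible-g₁g₂-⊝ w w∈W)
        where
        g₂w∈V : V (g₂ w)
        g₂w∈V = I₂.mapsTo w w∈W
        y = g₁ (g₂ w)
        c≡ : E.g₁ (E.g₂ (w ⊕ ψ a)) ⊝ (w ⊕ ψ a) ≡ y ⊝ w
        c≡ = begin
          E.g₁ (E.g₂ (w ⊕ ψ a)) ⊝ (w ⊕ ψ a)   ≡⟨ cong (λ z → E.g₁ z ⊝ (w ⊕ ψ a))
                                                    (J₂.additive w (ψ a) (W⊆W-E w w∈W) (B⊆W-E _ (IsLinIso.mapsTo ψ-iso a a∈A))) ⟩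
          E.g₁ (E.g₂ w ⊕ E.g₂ (ψ a)) ⊝ (w ⊕ ψ a) ≡⟨ cong (λ z → E.g₁ z ⊝ (w ⊕ ψ a))
                                                    (cong₂ _⊕_ (g₂-E-extends w w∈W) (g₂-E∘ψ≡id a a∈A)) ⟩
          E.g₁ (g₂ w ⊕ a) ⊝ (w ⊕ ψ a)         ≡⟨ cong (_⊝ (w ⊕ ψ a)) (J₁.additive _ _ (V⊆V-E _ g₂w∈V) (A⊆V-E a a∈A)) ⟩
          (E.g₁ (g₂ w) ⊕ E.g₁ a) ⊝ (w ⊕ ψ a)  ≡⟨ cong (λ z → z ⊝ (w ⊕ ψ a)) (cong₂ _⊕_ (g₁-E-extends _ g₂w∈V) (g₁-E≡ψ a a∈A)) ⟩
          (y ⊕ ψ a) ⊝ (w ⊕ ψ a)               ≡⟨ ⊕-⊝-interchange y (ψ a) w (ψ a) ⟩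
          (y ⊝ w) ⊕ (ψ a ⊝ ψ a)               ≡⟨ cong ((y ⊝ w) ⊕_) (⊕-inverseʳ (ψ a)) ⟩
          (y ⊝ w) ⊕ 𝟎                         ≡⟨ ⊕-identityʳ _ ⟩
          y ⊝ w                               ∎

    cs-admissible : ∀ {j} (u′ : Vec (Vector n) j) → All W⁺ u′ → All Admissible (zipWith _⊝_ (map E.g₁ (map E.g₂ u′)) u′)
    cs-admissible []       []          = []
    cs-admissible (x ∷ u′) (x∈ ∷ u′∈) = correction-admissible isTriv x x∈ ∷ cs-admissible u′ u′∈

    valid : Valid (cs , xs)
    valid = cs-admissible u u∈W⁺ , xs-free u u++bW-independent u∈W⁺

    xs++bV-independent : Independent (xs ++ bV)
    xs++bV-independent = IndependentOverV⇒Independent xs (proj₂ valid)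

    xs++bV∈V-E : All E.V (xs ++ bV)
    xs++bV∈V-E = ++⁺ (map⁺ (All.map (λ x∈ → J₂.mapsTo _ (W⁺⊆W-E _ x∈)) u∈W⁺)) (All.map (V⊆V-E _) bV∈V)

    map-g₁-E-xs++bV : map E.g₁ (xs ++ bV) ≡ zipWith _⊕_ u cs ++ g₁bV
    map-g₁-E-xs++bV = trans (map-++ E.g₁ xs bV)
      (cong₂ _++_ (sym (zipWith-⊕-⊝ u (map E.g₁ xs))) (map-cong-All bV bV∈V g₁-E-extends))
      where
      zipWith-⊕-⊝ : ∀ {j} (u′ ys : Vec (Vector n) j) → zipWith _⊕_ u′ (zipWith _⊝_ ys u′) ≡ ys
      zipWith-⊕-⊝ []       []       = refl
      zipWith-⊕-⊝ (x ∷ u′) (y ∷ ys) = cong₂ _∷_ (⊕-⊝-cancel x y) (zipWith-⊕-⊝ u′ ys)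

    V-E⊆span : ∀ v → E.V v → InSpan (xs ++ bV) v
    V-E⊆span v v∈ = proj₁ t , trans (sym (g₂-E-lc-u++bW (proj₁ t))) (trans (cong E.g₂ (proj₂ t)) (proj₂ (proj₂ w)))
      where
      w = J₂.surj v v∈
      t = W⁺⊆span (proj₁ w) (proj₁ (W-E⇔W⁺ (proj₁ w)) (proj₁ (proj₂ w)))

    same : Same (construct (cs , xs) valid) (E , isExt , isTriv , W-E⇔W⁺)
    same = (λ v → (λ (t , eq) → subst E.V eq (Subspace.lc-closed (proj₁ E.dimV) t _ xs++bV∈V-E)) , V-E⊆span v)
         , (λ w → W⁺⊆W-E w , proj₁ (W-E⇔W⁺ w))
         , (λ v (t , eq) → subst (λ z → extension-g₁ cs xs z ≡ E.g₁ z) eq (begin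
             extension-g₁ cs xs (lc t (xs ++ bV))  ≡⟨ linearExtension-lc xs++bV-independent t ⟩
             lc t (zipWith _⊕_ u cs ++ g₁bV)      ≡⟨ cong (lc t) map-g₁-E-xs++bV ⟨
             lc t (map E.g₁ (xs ++ bV))           ≡⟨ LinearMap.map-lc (proj₁ E.dimV) E.iso₁ t _ xs++bV∈V-E ⟨
             E.g₁ (lc t (xs ++ bV))               ∎))
         , λ w w∈ → let (t , eq) = W⁺⊆span w w∈ in
             subst (λ z → extension-g₂ xs z ≡ E.g₂ z) eq
               (trans (linearExtension-lc u++bW-independent t) (sym (g₂-E-lc-u++bW t)))

    decompose : Σ _ λ p → Σ (Valid p) λ valid → Same (construct p valid) (E , isExt , isTriv , W-E⇔W⁺)
    decompose = (cs , xs) , valid , same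

  IndependentOverV-size : ∀ j → Enumeration (IndependentOverV {j}) (prodFrom q n k j)
  IndependentOverV-size zero    = Enumeration-[] tt
  IndependentOverV-size (suc j) = Enumeration-∷ (λ _ _ z → z) (λ _ _ z → z) (IndependentOverV-size j)
    (λ xs xs-free → subst (Enumeration _) (cong (λ z → q ^ n ∸ q ^ z) (+-comm j k))
      (nonspan-size (xs ++ bV) (IndependentOverV⇒Independent xs xs-free)))

  module _ {k₁ : ℕ} (dimFix : HasDim F (Fix F P) k₁) where

    corrections-size : ∀ j → Enumeration (λ (cs : Vec (Vector n) j) → All Admissible cs) ((q ^ (k ∸ k₁)) ^ j)
    corrections-size zero    = Enumeration-[] []
    corrections-size (suc j) = subst (Enumeration _) (*-comm ((q ^ (k ∸ k₁)) ^ j) (q ^ (k ∸ k₁)))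
      (Enumeration-∷ (λ _ _ adm → All.tail adm , All.head adm) (λ _ _ (cs-adm , c-adm) → c-adm ∷ cs-adm)
        (corrections-size j) (λ _ _ → admissible-size dimFix))

    valid-size : Enumeration Valid (Eq q n k⁺ k k₁)
    valid-size = subst (Enumeration Valid) count
      (Enumeration-Σ (corrections-size m) (λ _ _ → IndependentOverV-size m))
      where
      k⁺∸k≡m : k⁺ ∸ k ≡ m
      k⁺∸k≡m = trans (cong (_∸ k) (sym m+k≡k⁺)) (m+n∸n≡m m k)
      count : (q ^ (k ∸ k₁)) ^ m ℕ.* prodFrom q n k m ≡ Eq q n k⁺ k k₁
      count = begin
        (q ^ (k ∸ k₁)) ^ m ℕ.* prodFrom q n k m    ≡⟨ cong (ℕ._* prodFrom q n k m) (^-*-assoc q (k ∸ k₁) m) ⟩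
        q ^ ((k ∸ k₁) ℕ.* m) ℕ.* prodFrom q n k m  ≡⟨ cong (λ j → q ^ ((k ∸ k₁) ℕ.* j) ℕ.* prodFrom q n k j) k⁺∸k≡m ⟨
        Eq q n k⁺ k k₁                             ∎

    trivial-extensions-count : HasCount Same (Eq q n k⁺ k k₁)
    trivial-extensions-count = HasCount-fromEnumeration {_~_ = Same} valid-size construct construct-injective
      (λ (E , isExt , isTriv , W-E⇔W⁺) → Decomposition.decompose {E} isExt isTriv W-E⇔W⁺)
      (λ p valid valid′ a → Same-trans {construct p valid′} {construct p valid} {a} (construct-irrelevant p valid′ valid))

module Mirror (F : FiniteField) {n : ℕ} where

  open import Data.Product using (_,_; proj₁; proj₂)
  open import Relation.Binary.PropositionalEquality

  open VectorAlgebra F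
  open Span F

  swap : PartialIso F {n} → PartialIso F {n}
  swap P = record
    { V = W ; W = V ; g₁ = g₂ ; g₂ = g₁ ; degree = degree ; dimV = dimW ; dimW = dimV ; iso₁ = iso₂ ; iso₂ = iso₁ }
    where open PartialIso P

  IsExtension-swap : ∀ {P E} → IsExtension F P E → IsExtension F (swap P) (swap E)
  IsExtension-swap (V⊆ , W⊆ , g₁-extends , g₂-extends) = W⊆ , V⊆ , g₂-extends , g₁-extends

  IsTrivial-swap : ∀ {P E} → IsTrivial F P E → IsTrivial F (swap P) (swap E)
  IsTrivial-swap {E = E} (A , B , ψ , A-sub , B-sub , A⊆ , V∩A , V≡V+A , B⊆ , W∩B , W≡W+B , ψ-iso , g₁≡ψ , g₂∘ψ≡id) =
    B , A , g₂ , B-sub , A-sub , B⊆ , W∩B , W≡W+B , A⊆ , V∩A , V≡V+A , ψ⁻¹-iso , (λ _ _ → refl) , g₁∘g₂≡id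
    where
    open PartialIso E
    module J₂ = IsLinIso iso₂
    module Ψ = IsLinIso ψ-iso
    ψ⁻¹-iso : IsLinIso F B A g₂
    ψ⁻¹-iso = record
      { mapsTo   = λ b b∈ → let (a , a∈ , ψa≡b) = Ψ.surj b b∈ in subst A (trans (sym (g₂∘ψ≡id a a∈)) (cong g₂ ψa≡b)) a∈
      ; additive = λ x y x∈ y∈ → J₂.additive x y (B⊆ x x∈) (B⊆ y y∈)
      ; homog    = λ c x x∈ → J₂.homog c x (B⊆ x x∈)
      ; inj      = λ x y x∈ y∈ → J₂.inj x y (B⊆ x x∈) (B⊆ y y∈)
      ; surj     = λ a a∈ → ψ a , Ψ.mapsTo a a∈ , g₂∘ψ≡id a a∈ }
    g₁∘g₂≡id : ∀ b → B b → g₁ (g₂ b) ≡ b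
    g₁∘g₂≡id b b∈ = subst (λ z → g₁ (g₂ z) ≡ z) (proj₂ (proj₂ a)) (trans (cong g₁ (g₂∘ψ≡id _ a∈)) (g₁≡ψ _ a∈))
      where
      a = Ψ.surj b b∈
      a∈ = proj₁ (proj₂ a)

  SamePI-swap : ∀ {E E′} → SamePI F E E′ → SamePI F (swap E) (swap E′)
  SamePI-swap (V⇔ , W⇔ , g₁≡ , g₂≡) = W⇔ , V⇔ , g₂≡ , g₁≡

  TrivExtLeft⇒TrivExtRight-swap : ∀ {P X} → TrivExtLeft F P X → TrivExtRight F (swap P) X
  TrivExtLeft⇒TrivExtRight-swap {P} (E , isExt , isTriv , V⇔X) =
    swap E , IsExtension-swap {P} {E} isExt , IsTrivial-swap {P} {E} isTriv , V⇔X

  TrivExtRight⇒TrivExtLeft-swap : ∀ {P X} → TrivExtRight F P X → TrivExtLeft F (swap P) X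
  TrivExtRight⇒TrivExtLeft-swap {P} (E , isExt , isTriv , W⇔X) =
    swap E , IsExtension-swap {P} {E} isExt , IsTrivial-swap {P} {E} isTriv , W⇔X

  -- swap (swap P) is P on the nose, so right extensions of swap P are left extensions of P.
  HasCount-left : ∀ {P X N} → HasCount (SameExt F {n} {TrivExtRight F (swap P) X} proj₁) N →
    HasCount (SameExt F {n} {TrivExtLeft F P X} proj₁) N
  HasCount-left {P} {X} (f , f-injective , f-surjective) =
      (λ i → TrivExtRight⇒TrivExtLeft-swap {swap P} {X} (f i))
    , (λ i j same → f-injective i j (SamePI-swap {swap (proj₁ (f i))} {swap (proj₁ (f j))} same))
    , λ a → let (i , same) = f-surjective (TrivExtLeft⇒TrivExtRight-swap {P} {X} a)
            in i , SamePI-swap {proj₁ (f i)} {swap (proj₁ a)} same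

  Fix-swap-hasDim : ∀ (P : PartialIso F {n}) {k₁} → HasDim F (Fix F P) k₁ → HasDim F (Fix F (swap P)) k₁
  Fix-swap-hasDim P dimFix = HasDim-image dimFix Fix-swap-isSubspace g₁-Fix-isLinIso
    where
    open PartialIso P
    module I₁ = IsLinIso iso₁
    module I₂ = IsLinIso iso₂
    g₁-Fix-isLinIso : IsLinIso F (Fix F P) (Fix F (swap P)) g₁
    g₁-Fix-isLinIso = record
      { mapsTo   = λ x (x∈V , fixed) → I₁.mapsTo x x∈V , cong g₁ fixed
      ; additive = λ x y (x∈V , _) (y∈V , _) → I₁.additive x y x∈V y∈V
      ; homog    = λ c x (x∈V , _) → I₁.homog c x x∈V
      ; inj      = λ x y (x∈V , _) (y∈V , _) → I₁.inj x y x∈V y∈V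
      ; surj     = λ w (w∈W , fixed) → g₂ w , (I₂.mapsTo w w∈W , cong g₂ fixed) , fixed }
    module W-sub = IsSubspace (proj₁ dimW)
    Fix-swap-isSubspace : IsSubspace F (Fix F (swap P))
    Fix-swap-isSubspace = record
      { zero∈    = W-sub.zero∈ , trans (cong g₁ (LinearMap.map-𝟎 (proj₁ dimW) iso₂)) (LinearMap.map-𝟎 (proj₁ dimV) iso₁)
      ; +-closed = λ x y (x∈W , x-fixed) (y∈W , y-fixed) → W-sub.+-closed x y x∈W y∈W ,
          trans (cong g₁ (I₂.additive x y x∈W y∈W))
            (trans (I₁.additive _ _ (I₂.mapsTo x x∈W) (I₂.mapsTo y y∈W)) (cong₂ _⊕_ x-fixed y-fixed))
      ; ·-closed = λ c x (x∈W , x-fixed) → W-sub.·-closed c x x∈W ,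
          trans (cong g₁ (I₂.homog c x x∈W)) (trans (I₁.homog c _ (I₂.mapsTo x x∈W)) (cong (c ⊙_) x-fixed)) }

corollary2p4 : (F : FiniteField) (n : ℕ) → 1 ≤ n
    → (P : PartialIso F {n}) (k₁ : ℕ) → HasDim F (Fix F P) k₁
    → ((W⁺ : Pred F {n}) (k⁺ : ℕ) → HasDim F W⁺ k⁺ → PartialIso.degree P ≤ k⁺
        → _⊆_ F (PartialIso.W P) W⁺
        → HasCount (SameExt F {n} {TrivExtRight F P W⁺} proj₁)
            (Eq (FiniteField.q F) n k⁺ (PartialIso.degree P) k₁))
    × ((V⁺ : Pred F {n}) (k⁺ : ℕ) → HasDim F V⁺ k⁺ → PartialIso.degree P ≤ k⁺
        → _⊆_ F (PartialIso.V P) V⁺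
        → HasCount (SameExt F {n} {TrivExtLeft F P V⁺} proj₁)
            (Eq (FiniteField.q F) n k⁺ (PartialIso.degree P) k₁))
corollary2p4 F n _ P k₁ dimFix =
    (λ W⁺ k⁺ dimW⁺ _ W⊆W⁺ → RightExtensions.trivial-extensions-count F P W⁺ dimW⁺ W⊆W⁺ dimFix)
  , (λ V⁺ k⁺ dimV⁺ _ V⊆V⁺ → Mirror.HasCount-left F {P = P} {X = V⁺}
      (RightExtensions.trivial-extensions-count F (Mirror.swap F P) V⁺ dimV⁺ V⊆V⁺ (Mirror.Fix-swap-hasDim F P dimFix)))
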